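{- Let $q=q_{\mathbf{B}}$ be the incidence form of a bidirected graph $\mathbf{B}$, and assume $q$ is connected and irreducible. Then the following are equivalent: (a) $q$ is positive; (b) $\mathcal{R}_q(0)=\{0\}$; (c) the set $\mathcal{R}_q(1)$ is finite; (d) the set $\mathcal{R}^{\rm inc}_{\mathbf{B}}$ is finite.
   Context: A bidirected graph $\mathbf{B}$: vertices, arrows $E(\mathbf{B})=\{1,\dots,n\}\ne\emptyset$, each arrow $i$ with signed endpoints $\mathbbm{v}(i)=\{(u,\epsilon),(u',\epsilon')\}$; sign $\sigma(i)=-\epsilon\epsilon'$. $I(\mathbf{B})^Te_i=\epsilon e_u+\epsilon'e_{u'}$ and $q_{\mathbf{B}}(x)=\frac12x^TI(\mathbf{B})I(\mathbf{B})^Tx=\sum q_ix_i^2+\sum_{i<j}q_{ij}x_ix_j$. The form is connected if the graph $i\sim j$ iff $q_{ij}\ne0$ is connected; irreducible if $q=aq'$ with $q'$ integral forces $a=\pm1$; positive if $q(x)>0$ for $x\ne0$. $\mathcal{R}_q(d)=\{x\in\mathbb{Z}^n:q(x)=d\}$. Walks: sequences $(v_0,i_1,v_1,\dots,i_\ell,v_\ell)$ with each $i_t$ an arrow (or formal inverse $i^{ -1}$ of a directed loop, same endpoints and sign) joining $v_{t-1},v_t$. With $d(v,i)=d$ if $(v,d)\in\mathbbm{v}(i)$, $(v,-d)\notin\mathbbm{v}(i)$; $d(v,i)=1$ for a directed loop at $v$, $d(v,i^{ -1})=-1$; $0$ otherwise, set $\mathrm{inc}(\omega)=\sum_{t}\sigma(\omega^{[t-1]})d(v_{t-1},i_t)e_{i_t}$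 ($\omega^{[t]}$ the initial subwalk of length $t$, $\sigma$ of a walk the product of signs, $e_{i^{ -1}}=e_i$). $\mathcal{R}^{\rm inc}_{\mathbf{B}}=\{\pm\mathrm{inc}(\omega):\omega\text{ a walk of }\mathbf{B}\}$. -}

module Defs where

open import Data.Nat as ℕ using (ℕ; zero; suc)
open import Data.Integer as ℤ using (ℤ; +_; _+_; _*_; -_; 0ℤ; 1ℤ; -1ℤ)
open import Data.Fin as Fin using (Fin; zero; suc)
open import Data.Fin.Properties as FinP using ()
open import Data.Sign as Sgn using (Sign)
open import Data.Sign.Properties as SgnP using ()
open import Data.Bool using (Bool; true; false; if_then_else_; _∧_; _∨_; not)
open import Data.Product using (_×_; _,_; proj₁; proj₂; ∃)
open import Data.Sum using (_⊎_)
open import Data.Vec using (Vec; lookup; tabulate; replicate; map; zipWith)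
open import Data.List using (List)
open import Data.List.Membership.Propositional using (_∈_)
open import Relation.Nullary using (does; ¬_)
open import Relation.Binary.PropositionalEquality using (_≡_; _≢_)

sumFin : ∀ {k} → (Fin k → ℤ) → ℤ
sumFin {zero} f = 0ℤ
sumFin {suc k} f = f zero + sumFin (λ i → f (suc i))

signℤ : Sign → ℤ
signℤ Sgn.+ = 1ℤ
signℤ Sgn.- = -1ℤ

-- Arrow i has the two signed endpoints end₁ i = (u , ε) and end₂ i = (u' , ε')
-- (the unordered pair {(u,ε),(u',ε')} is represented by an ordered pair;
-- every notion below is symmetric in the two endpoints).
record BiGraph (m n : ℕ) : Set where
  field
    end₁ end₂ : Fin n → Fin m × Sign

module _ {m n : ℕ} (B : BiGraph m n) where
  open BiGraph B

  u₁ u₂ : Fin n → Fin m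
  u₁ i = proj₁ (end₁ i)
  u₂ i = proj₁ (end₂ i)
  ε₁ ε₂ : Fin n → Sign
  ε₁ i = proj₂ (end₁ i)
  ε₂ i = proj₂ (end₂ i)

  δ : Fin m → Fin m → ℤ
  δ u v = if does (u Fin.≟ v) then 1ℤ else 0ℤ

  -- I(B)^T e_i = ε e_u + ε' e_u'
  col : Fin n → Fin m → ℤ
  col i v = signℤ (ε₁ i) * δ (u₁ i) v + signℤ (ε₂ i) * δ (u₂ i) v

  dot : (Fin m → ℤ) → (Fin m → ℤ) → ℤ
  dot f g = sumFin (λ v → f v * g v)

  -- coefficients of q_B(x) = ½ xᵀ I Iᵀ x = Σ q_i x_i² + Σ_{i<j} q_ij x_i x_j
  qDiag : Fin n → ℤ
  qDiag i = + (ℤ.∣ dot (col i) (col i) ∣ ℕ./ 2)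

  qOff : Fin n → Fin n → ℤ
  qOff i j = dot (col i) (col j)

  q : Vec ℤ n → ℤ
  q x = sumFin (λ i → qDiag i * (lookup x i * lookup x i))
      + sumFin (λ i → sumFin (λ j →
          if does (i FinP.<? j) then qOff i j * (lookup x i * lookup x j) else 0ℤ))

  data Linked : Fin n → Fin n → Set where
    here : ∀ {i} → Linked i i
    step : ∀ {i j k} → i ≢ j → qOff i j ≢ 0ℤ → Linked j k → Linked i k

  Connected : Set
  Connected = ∀ i j → Linked i j

  Irreducible : Set
  Irreducible = (a : ℤ) (c : Fin n → ℤ) (c₂ : Fin n → Fin n → ℤ) →
    (∀ i → qDiag i ≡ a * c i) →
    (∀ i j → i Fin.< j → qOff i j ≡ a * c₂ i j) →
    a ≡ 1ℤ ⊎ a ≡ -1ℤ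

  Positive : Set
  Positive = ∀ x → x ≢ replicate n 0ℤ → 0ℤ ℤ.< q x

  R : ℤ → Vec ℤ n → Set
  R d x = q x ≡ d

  DirLoop : Fin n → Set
  DirLoop i = u₁ i ≡ u₂ i × ε₁ i ≢ ε₂ i

  data Step : Set where
    fwd : Fin n → Step
    inv : (i : Fin n) → DirLoop i → Step

  arrowOf : Step → Fin n
  arrowOf (fwd i) = i
  arrowOf (inv i _) = i

  Joins : Fin m → Step → Fin m → Set
  Joins v s w = (v ≡ u₁ (arrowOf s) × w ≡ u₂ (arrowOf s))
              ⊎ (v ≡ u₂ (arrowOf s) × w ≡ u₁ (arrowOf s))

  data Walk : Fin m → Set where
    [] : ∀ {v} → Walk v
    _∷⟨_⟩_ : ∀ {v w} (s : Step) → Joins v s w → Walk w → Walk v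

  σ : Step → ℤ
  σ s = - (signℤ (ε₁ (arrowOf s)) * signℤ (ε₂ (arrowOf s)))

  eqV : Fin m → Fin m → Bool
  eqV u v = does (u Fin.≟ v)

  eqS : Sign → Sign → Bool
  eqS a b = does (a SgnP.≟ b)

  mem : Fin m → Sign → Fin n → Bool
  mem v d i = (eqV (u₁ i) v ∧ eqS (ε₁ i) d) ∨ (eqV (u₂ i) v ∧ eqS (ε₂ i) d)

  dirLoopAt : Fin m → Fin n → Bool
  dirLoopAt v i = eqV (u₁ i) v ∧ eqV (u₂ i) v ∧ not (eqS (ε₁ i) (ε₂ i))

  dArr : Fin m → Fin n → ℤ
  dArr v i =
    if dirLoopAt v i then 1ℤ
    else if mem v Sgn.+ i ∧ not (mem v Sgn.- i) then 1ℤ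
    else if mem v Sgn.- i ∧ not (mem v Sgn.+ i) then -1ℤ
    else 0ℤ

  dStep : Fin m → Step → ℤ
  dStep v (fwd i) = dArr v i
  dStep v (inv i _) = -1ℤ

  e : Fin n → Vec ℤ n
  e i = tabulate (λ j → if does (i Fin.≟ j) then 1ℤ else 0ℤ)

  _+ᵥ_ : Vec ℤ n → Vec ℤ n → Vec ℤ n
  _+ᵥ_ = zipWith _+_

  _·ᵥ_ : ℤ → Vec ℤ n → Vec ℤ n
  a ·ᵥ x = map (a *_) x

  -ᵥ_ : Vec ℤ n → Vec ℤ n
  -ᵥ x = map -_ x

  -- incAux acc ω = Σ_t acc·σ(ω^{[t-1]}) d(v_{t-1}, i_t) e_{i_t}
  incAux : ℤ → ∀ {v} → Walk v → Vec ℤ n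
  incAux acc [] = replicate n 0ℤ
  incAux acc {v} (s ∷⟨ _ ⟩ ω) =
    ((acc * dStep v s) ·ᵥ e (arrowOf s)) +ᵥ incAux (acc * σ s) ω

  inc : ∀ {v} → Walk v → Vec ℤ n
  inc ω = incAux 1ℤ ω

  Rinc : Vec ℤ n → Set
  Rinc x = ∃ λ v → ∃ λ (ω : Walk v) → x ≡ inc ω ⊎ x ≡ -ᵥ inc ω

FiniteSet : ∀ {n} → (Vec ℤ n → Set) → Set
FiniteSet {n} P = ∃ λ (L : List (Vec ℤ n)) → ∀ x → P x → x ∈ L

-- Iᵀ sends x to the vertex vector Σᵢ xᵢ Iᵀeᵢ, and 2 q(x) = ‖Iᵀx‖², so q is positive exactly when
-- Iᵀ is injective, and q(x) = 0 exactly when Iᵀx = 0. If Iᵀx = s eₐ - t e_b with units s, t, then x can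
-- be peeled off one unit at a time along arrows: x = s·inc(ω) + r for a walk ω from a to b and r in
-- the kernel. Hence, for positive q, every x with q(x) = 1 (so ‖Iᵀx‖² = 2) lies in R^inc; and R^inc is
-- finite, because inc(ω) is determined by the endpoints and the sign of ω, and erasing repeated
-- (vertex, sign) states shortens every walk to bounded length without changing those. Conversely a
-- nonzero kernel element x gives a closed walk of sign 1 with nonzero incidence vector, whose powers
-- make R^inc infinite, and, for an arrow i that is not a loop (irreducibility provides one), the
-- vectors eᵢ + k x make R_q(1) infinite.

module Submission where

open import Defs
open import Data.Nat as ℕ using (ℕ; zero; suc; z≤n; s≤s)
import Data.Nat.Properties as ℕP
open import Data.Nat.DivMod using (m*n/n≡m)
open import Data.Integer as ℤ
  using (ℤ; +_; -[1+_]; _+_; _*_; -_; _-_; 0ℤ; 1ℤ; -1ℤ; _≤_; _<_; +≤+; +<+)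
import Data.Integer.Properties as ℤP
open import Algebra.Properties.AbelianGroup ℤP.+-0-abelianGroup using (∙-cancelˡ)
open import Data.Integer.Tactic.RingSolver using (solve-∀)
open import Algebra.Properties.Semiring.Sum ℤP.+-*-semiring
  using (sum; sum-syntax; sum-cong-≗; sum-replicate-zero; ∑-distrib-+; ∑-comm; *-distribˡ-sum; *-distribʳ-sum)
open import Data.Fin as Fin using (Fin; zero; suc)
import Data.Fin.Properties as FinP
open import Data.Bool using (Bool; true; false; if_then_else_; _∧_; _∨_; not)
import Data.Sign.Properties as SignP
open import Data.Sign as Sgn using (Sign)
import Data.Product.Properties as ×P
open import Data.Product using (_×_; _,_; proj₁; proj₂; ∃; Σ-syntax)
open import Data.Sum using (_⊎_; inj₁; inj₂)
open import Data.Empty using (⊥; ⊥-elim)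
open import Function using (_∘_)
open import Relation.Binary using (tri<; tri≈; tri>)
open import Relation.Nullary using (does; ¬_; ¬?; yes; no)
open import Relation.Nullary.Decidable using (dec-true; dec-false)
open import Relation.Binary.PropositionalEquality
open import Relation.Binary.Definitions using (DecidableEquality)
open import Function.Bundles using (_⇔_; mk⇔; Equivalence)
open import Data.List as List using (List; []; _∷_; length; filter)
open import Data.List.Properties using (filter-notAll)
open import Data.List.Relation.Unary.All as All using (All; [])
open import Data.List.Relation.Unary.Any as Any using (here; there)
open import Data.List.Relation.Unary.Unique.Propositional using (Unique)
open import Data.List.Relation.Unary.AllPairs using ([]; _∷_)
open import Data.List.Relation.Unary.All.Properties using (¬Any⇒All¬)
open import Data.List.Relation.Binary.Subset.Propositional using (_⊆_)
open import Data.List.Membership.Propositional using (_∈_; _∉_)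
open import Data.List.Membership.Propositional.Properties
  using (∈-filter⁺; ∈-map⁺; ∈-concat⁺′; ∈-tabulate⁺; ∈-allFin; ∈-++⁺ˡ; ∈-++⁺ʳ; ∈-cartesianProduct⁺)
open import Data.List.Extrema.Nat using (argmax; f[xs]≤f[argmax])
open import Data.Vec using (Vec; lookup; replicate; _[_]%=_)
import Data.Vec.Properties as VecP
open import Data.Vec.Properties using (lookup∘updateAt; lookup∘updateAt′)
import Algebra.Properties.Semiring.Sum ℕP.+-*-semiring as ℕΣ

private variable k : ℕ

IsUnit : ℤ → Set
IsUnit a = a ≡ 1ℤ ⊎ a ≡ -1ℤ

unit-* : ∀ {a b} → IsUnit a → IsUnit b → IsUnit (a * b)
unit-* (inj₁ refl) (inj₁ refl) = inj₁ refl
unit-* (inj₁ refl) (inj₂ refl) = inj₂ refl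
unit-* (inj₂ refl) (inj₁ refl) = inj₂ refl
unit-* (inj₂ refl) (inj₂ refl) = inj₁ refl

unit-neg : ∀ {a} → IsUnit a → IsUnit (- a)
unit-neg (inj₁ refl) = inj₂ refl
unit-neg (inj₂ refl) = inj₁ refl

unit-sq : ∀ {a} → IsUnit a → a * a ≡ 1ℤ
unit-sq (inj₁ refl) = refl
unit-sq (inj₂ refl) = refl

signℤ-unit : ∀ s → IsUnit (signℤ s)
signℤ-unit Sgn.+ = inj₁ refl
signℤ-unit Sgn.- = inj₂ refl

unit-aligned : ∀ a → a ≢ 0ℤ → Σ[ s ∈ ℤ ] IsUnit s × 0ℤ < s * a
unit-aligned (+ 0) a≢0 = ⊥-elim (a≢0 refl)
unit-aligned (+ suc n) _ = 1ℤ , inj₁ refl , +<+ (s≤s z≤n)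
unit-aligned -[1+ n ] _ = -1ℤ , inj₂ refl , +<+ (s≤s z≤n)

unit-cancel : ∀ {s a} → IsUnit s → s * a ≡ s → a ≡ 1ℤ
unit-cancel {a = a} (inj₁ refl) eq = trans (sym (ℤP.*-identityˡ a)) eq
unit-cancel {a = a} (inj₂ refl) eq = ℤP.neg-injective (trans (sym (ℤP.-1*i≡-i a)) eq)

sign-sum-even : ∀ ε ε′ → Σ[ h ∈ ℤ ] signℤ ε + signℤ ε′ ≡ + 2 * h
sign-sum-even Sgn.+ Sgn.+ = 1ℤ , refl
sign-sum-even Sgn.+ Sgn.- = 0ℤ , refl
sign-sum-even Sgn.- Sgn.+ = 0ℤ , refl
sign-sum-even Sgn.- Sgn.- = -1ℤ , refl

kron : Fin k → Fin k → ℤ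
kron i j = if does (i Fin.≟ j) then 1ℤ else 0ℤ

kron-refl : (i : Fin k) → kron i i ≡ 1ℤ
kron-refl i = cong (if_then 1ℤ else 0ℤ) (dec-true (i Fin.≟ i) refl)

kron-≢ : {i j : Fin k} → i ≢ j → kron i j ≡ 0ℤ
kron-≢ {i = i} {j} i≢j = cong (if_then 1ℤ else 0ℤ) (dec-false (i Fin.≟ j) i≢j)

kron-suc : (i j : Fin k) → kron (suc i) (suc j) ≡ kron i j
kron-suc i j with i Fin.≟ j
... | yes _ = refl
... | no _ = refl

kron-01 : (i j : Fin k) → kron i j ≡ 1ℤ ⊎ kron i j ≡ 0ℤ
kron-01 i j with i Fin.≟ j
... | yes _ = inj₁ refl
... | no _ = inj₂ refl

kron-sym : (i j : Fin k) → kron i j ≡ kron j i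
kron-sym i j with i Fin.≟ j | j Fin.≟ i
... | yes _ | yes _ = refl
... | no _ | no _ = refl
... | yes i≡j | no j≢i = ⊥-elim (j≢i (sym i≡j))
... | no i≢j | yes j≡i = ⊥-elim (i≢j (sym j≡i))

kron-sq : (i j : Fin k) → kron i j * kron i j ≡ kron i j
kron-sq i j with kron-01 i j
... | inj₁ eq rewrite eq = refl
... | inj₂ eq rewrite eq = refl

unit-kron-nonneg : ∀ {c} → IsUnit c → (i j : Fin k) → 0ℤ ≤ 1ℤ + c * kron i j
unit-kron-nonneg c-unit i j with kron-01 i j
unit-kron-nonneg (inj₁ refl) i j | inj₁ eq rewrite eq = +≤+ z≤n
unit-kron-nonneg (inj₂ refl) i j | inj₁ eq rewrite eq = +≤+ z≤n
unit-kron-nonneg (inj₁ refl) i j | inj₂ eq rewrite eq = +≤+ z≤n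
unit-kron-nonneg (inj₂ refl) i j | inj₂ eq rewrite eq = +≤+ z≤n

same-end⊎departs : ∀ {a b : Fin k} {s t} → IsUnit s → IsUnit t →
  (a ≡ b × s ≡ t) ⊎ 0ℤ < s * (s * kron a a - t * kron b a)
same-end⊎departs {a = a} {b} {s} {t} s-unit t-unit with a Fin.≟ b | s ℤ.≟ t
... | yes refl | yes refl = inj₁ (refl , refl)
... | yes refl | no s≢t = inj₂ (subst (λ κ → 0ℤ < s * (s * κ - t * κ)) (sym (kron-refl a)) (opposite s-unit t-unit s≢t))
  where
  opposite : ∀ {s t} → IsUnit s → IsUnit t → s ≢ t → 0ℤ < s * (s * 1ℤ - t * 1ℤ)
  opposite (inj₁ refl) (inj₁ refl) s≢t = ⊥-elim (s≢t refl)
  opposite (inj₁ refl) (inj₂ refl) _ = +<+ (s≤s z≤n)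
  opposite (inj₂ refl) (inj₁ refl) _ = +<+ (s≤s z≤n)
  opposite (inj₂ refl) (inj₂ refl) s≢t = ⊥-elim (s≢t refl)
... | no a≢b | _ = inj₂ (subst₂ (λ κ κ′ → 0ℤ < s * (s * κ - t * κ′)) (sym (kron-refl a)) (sym (kron-≢ (a≢b ∘ sym)))
                          (subst (0ℤ <_) (sym (trans (square s t) (unit-sq s-unit))) (+<+ (s≤s z≤n))))
  where
  square : ∀ s t → s * (s * 1ℤ - t * 0ℤ) ≡ s * s
  square = solve-∀

-- Finite sums and sums of squares

sumFin≡sum : (f : Fin k → ℤ) → sumFin f ≡ sum f
sumFin≡sum {zero} f = refl
sumFin≡sum {suc k} f = cong (λ s → f zero + s) (sumFin≡sum (λ i → f (suc i)))

∑-kron : (i : Fin k) (f : Fin k → ℤ) → ∑[ j < k ] (kron i j * f j) ≡ f i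
∑-kron {suc k} zero f = begin
  1ℤ * f zero + ∑[ j < k ] (kron zero (suc j) * f (suc j))
    ≡⟨ cong₂ _+_ (ℤP.*-identityˡ (f zero)) (trans (sum-cong-≗ (λ j → ℤP.*-zeroˡ (f (suc j)))) (sum-replicate-zero k)) ⟩
  f zero + 0ℤ ≡⟨ ℤP.+-identityʳ (f zero) ⟩
  f zero ∎
  where open ≡-Reasoning
∑-kron {suc k} (suc i) f = begin
  0ℤ * f zero + ∑[ j < k ] (kron (suc i) (suc j) * f (suc j))
    ≡⟨ cong₂ _+_ (ℤP.*-zeroˡ (f zero)) (sum-cong-≗ (λ j → cong (_* f (suc j)) (kron-suc i j))) ⟩
  0ℤ + ∑[ j < k ] (kron i j * f (suc j)) ≡⟨ ℤP.+-identityˡ _ ⟩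
  ∑[ j < k ] (kron i j * f (suc j)) ≡⟨ ∑-kron i (λ j → f (suc j)) ⟩
  f (suc i) ∎
  where open ≡-Reasoning

∑-nonneg : (f : Fin k → ℤ) → (∀ i → 0ℤ ≤ f i) → 0ℤ ≤ sum f
∑-nonneg {zero} f f≥0 = ℤP.≤-refl
∑-nonneg {suc k} f f≥0 = ℤP.+-mono-≤ (f≥0 zero) (∑-nonneg (λ i → f (suc i)) (λ i → f≥0 (suc i)))

∑-nonneg-zero : (f : Fin k → ℤ) → (∀ i → 0ℤ ≤ f i) → sum f ≡ 0ℤ → ∀ i → f i ≡ 0ℤ
∑-nonneg-zero {suc k} f f≥0 f₀+rest≡0 = λ where
    zero → ℤP.≤-antisym (subst (f zero ≤_) f₀+rest≡0 (ℤP.i≤i+j (f zero) rest)) (f≥0 zero)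
    (suc i) → ∑-nonneg-zero (λ j → f (suc j)) (λ j → f≥0 (suc j))
                (ℤP.≤-antisym (subst (rest ≤_) f₀+rest≡0 (ℤP.i≤j+i rest (f zero))) rest≥0) i
  where
  rest = ∑[ j < k ] f (suc j)
  rest≥0 = ∑-nonneg (λ j → f (suc j)) (λ j → f≥0 (suc j))
  instance
    _ : ℤ.NonNegative rest
    _ = ℤ.nonNegative rest≥0
    _ : ℤ.NonNegative (f zero)
    _ = ℤ.nonNegative (f≥0 zero)

∑-pos : (f : Fin k → ℤ) → 0ℤ < sum f → ∃ λ i → 0ℤ < f i
∑-pos {zero} f (+<+ ())
∑-pos {suc k} f 0<∑ with 0ℤ ℤ.<? f zero
... | yes 0<f₀ = zero , 0<f₀
... | no f₀≯0 with ∑-pos (λ i → f (suc i)) (ℤP.≰⇒> λ rest≤0 →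
                     ℤP.<⇒≱ 0<∑ (ℤP.+-mono-≤ (ℤP.≮⇒≥ f₀≯0) rest≤0))
...   | i , 0<fᵢ = suc i , 0<fᵢ

sq-nonneg : ∀ a → 0ℤ ≤ a * a
sq-nonneg (+ n) = subst (0ℤ ≤_) (ℤP.pos-* n n) (+≤+ z≤n)
sq-nonneg -[1+ n ] = +≤+ z≤n

zero⊎unit⊎sq≥4 : ∀ a → a ≡ 0ℤ ⊎ IsUnit a ⊎ + 4 ≤ a * a
zero⊎unit⊎sq≥4 (+ 0) = inj₁ refl
zero⊎unit⊎sq≥4 (+ 1) = inj₂ (inj₁ (inj₁ refl))
zero⊎unit⊎sq≥4 -[1+ 0 ] = inj₂ (inj₁ (inj₂ refl))
zero⊎unit⊎sq≥4 (+ suc (suc n)) = inj₂ (inj₂ (+≤+ (ℕP.*-mono-≤ {2} {2 ℕ.+ n} (s≤s (s≤s z≤n)) (s≤s (s≤s z≤n)))))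
zero⊎unit⊎sq≥4 -[1+ suc n ] = inj₂ (inj₂ (+≤+ (ℕP.*-mono-≤ {2} {2 ℕ.+ n} (s≤s (s≤s z≤n)) (s≤s (s≤s z≤n)))))

sumSq : (Fin k → ℤ) → ℤ
sumSq {k} y = ∑[ u < k ] (y u * y u)

sumSq-nonneg : (y : Fin k → ℤ) → 0ℤ ≤ sumSq y
sumSq-nonneg y = ∑-nonneg (λ u → y u * y u) (λ u → sq-nonneg (y u))

head-sq≤sumSq : (y : Fin (suc k) → ℤ) → y zero * y zero ≤ sumSq y
head-sq≤sumSq y = subst (_≤ sumSq y) (ℤP.+-identityʳ _) (ℤP.+-monoʳ-≤ (y zero * y zero) (sumSq-nonneg (λ u → y (suc u))))

sumSq≡0 : (y : Fin k → ℤ) → sumSq y ≡ 0ℤ → ∀ u → y u ≡ 0ℤ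
sumSq≡0 y h u with ℤP.i*j≡0⇒i≡0∨j≡0 (y u) (∑-nonneg-zero (λ v → y v * y v) (λ v → sq-nonneg (y v)) h u)
... | inj₁ yᵤ≡0 = yᵤ≡0
... | inj₂ yᵤ≡0 = yᵤ≡0

sumSq≡1 : (y : Fin k → ℤ) → sumSq y ≡ 1ℤ →
  Σ[ b ∈ Fin k ] Σ[ t ∈ ℤ ] IsUnit t × (∀ u → y u ≡ t * kron b u)
sumSq≡1 {suc k} y h with zero⊎unit⊎sq≥4 (y zero)
... | inj₁ y₀≡0 with sumSq≡1 (λ u → y (suc u)) (trans (sym (ℤP.+-identityˡ _)) (subst (λ a → a * a + sumSq (λ u → y (suc u)) ≡ 1ℤ) y₀≡0 h))
...   | b , t , t-unit , y′≡ = suc b , t , t-unit , λ where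
          zero → trans y₀≡0 (sym (ℤP.*-zeroʳ t))
          (suc u) → trans (y′≡ u) (cong (t *_) (sym (kron-suc b u)))
sumSq≡1 {suc k} y h | inj₂ (inj₁ y₀-unit) = zero , y zero , y₀-unit , λ where
    zero → sym (ℤP.*-identityʳ (y zero))
    (suc u) → trans (sumSq≡0 (λ v → y (suc v)) rest≡0 u) (sym (ℤP.*-zeroʳ (y zero)))
  where
  rest≡0 : sumSq (λ v → y (suc v)) ≡ 0ℤ
  rest≡0 = ∙-cancelˡ 1ℤ (sumSq (λ v → y (suc v))) 0ℤ (subst (λ a → a + sumSq (λ v → y (suc v)) ≡ 1ℤ) (unit-sq y₀-unit) h)
sumSq≡1 {suc k} y h | inj₂ (inj₂ 4≤y₀²) = ⊥-elim (ℤP.<⇒≱ (+<+ (s≤s (s≤s z≤n))) (ℤP.≤-trans 4≤y₀² (subst (y zero * y zero ≤_) h (head-sq≤sumSq y))))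

sumSq≡2 : (y : Fin k → ℤ) → sumSq y ≡ + 2 →
  Σ[ a ∈ Fin k ] Σ[ b ∈ Fin k ] Σ[ s ∈ ℤ ] Σ[ t ∈ ℤ ]
    IsUnit s × IsUnit t × (∀ u → y u ≡ s * kron a u + t * kron b u)
sumSq≡2 {suc k} y h with zero⊎unit⊎sq≥4 (y zero)
... | inj₁ y₀≡0 with sumSq≡2 (λ u → y (suc u)) (trans (sym (ℤP.+-identityˡ _)) (subst (λ a → a * a + sumSq (λ u → y (suc u)) ≡ + 2) y₀≡0 h))
...   | a , b , s , t , s-unit , t-unit , y′≡ = suc a , suc b , s , t , s-unit , t-unit , λ where
          zero → trans y₀≡0 (sym (cong₂ _+_ (ℤP.*-zeroʳ s) (ℤP.*-zeroʳ t)))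
          (suc u) → trans (y′≡ u) (sym (cong₂ (λ p q → s * p + t * q) (kron-suc a u) (kron-suc b u)))
sumSq≡2 {suc k} y h | inj₂ (inj₁ y₀-unit) with sumSq≡1 (λ u → y (suc u)) (∙-cancelˡ 1ℤ (sumSq (λ u → y (suc u))) 1ℤ (subst (λ a → a + sumSq (λ u → y (suc u)) ≡ + 2) (unit-sq y₀-unit) h))
... | b , t , t-unit , y′≡ = zero , suc b , y zero , t , y₀-unit , t-unit , λ where
        zero → sym (first (y zero) t)
        (suc u) → trans (y′≡ u) (trans (cong (t *_) (sym (kron-suc b u))) (sym (second (y zero) t _)))
  where
  first : ∀ y₀ t → y₀ * 1ℤ + t * 0ℤ ≡ y₀
  first = solve-∀
  second : ∀ y₀ t δ → y₀ * 0ℤ + t * δ ≡ t * δ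
  second = solve-∀
sumSq≡2 {suc k} y h | inj₂ (inj₂ 4≤y₀²) = ⊥-elim (ℤP.<⇒≱ (+<+ (s≤s (s≤s (s≤s z≤n)))) (ℤP.≤-trans 4≤y₀² (subst (y zero * y zero ≤_) h (head-sq≤sumSq y))))

sumSq-linear : ∀ {n m} (x : Fin n → ℤ) (c : Fin n → Fin m → ℤ) →
  sumSq (λ v → ∑[ i < n ] (x i * c i v)) ≡ ∑[ i < n ] ∑[ j < n ] (x i * x j * ∑[ v < m ] (c i v * c j v))
sumSq-linear {n} {m} x c = begin
  ∑[ v < m ] (∑[ i < n ] (x i * c i v) * ∑[ j < n ] (x j * c j v))
    ≡⟨ sum-cong-≗ (λ v → trans (*-distribʳ-sum _ (λ i → x i * c i v))
                               (sum-cong-≗ (λ i → *-distribˡ-sum (x i * c i v) (λ j → x j * c j v)))) ⟩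
  ∑[ v < m ] ∑[ i < n ] ∑[ j < n ] (x i * c i v * (x j * c j v))
    ≡⟨ trans (∑-comm (λ v i → ∑[ j < n ] (x i * c i v * (x j * c j v))))
             (sum-cong-≗ (λ i → ∑-comm (λ v j → x i * c i v * (x j * c j v)))) ⟩
  ∑[ i < n ] ∑[ j < n ] ∑[ v < m ] (x i * c i v * (x j * c j v))
    ≡⟨ sum-cong-≗ (λ i → sum-cong-≗ (λ j → trans (sum-cong-≗ (λ v → regroup (x i) (x j) (c i v) (c j v)))
                                                   (sym (*-distribˡ-sum (x i * x j) (λ v → c i v * c j v))))) ⟩
  ∑[ i < n ] ∑[ j < n ] (x i * x j * ∑[ v < m ] (c i v * c j v)) ∎
  where
  open ≡-Reasoning
  regroup : ∀ a b p q → a * p * (b * q) ≡ a * b * (p * q)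
  regroup = solve-∀

ifLess : Fin k → Fin k → ℤ → ℤ
ifLess i j a = if does (i FinP.<? j) then a else 0ℤ

ifLess-yes : {i j : Fin k} (a : ℤ) → i Fin.< j → ifLess i j a ≡ a
ifLess-yes {i = i} {j} a i<j = cong (if_then a else 0ℤ) (dec-true (i FinP.<? j) i<j)

ifLess-no : {i j : Fin k} (a : ℤ) → ¬ i Fin.< j → ifLess i j a ≡ 0ℤ
ifLess-no {i = i} {j} a i≮j = cong (if_then a else 0ℤ) (dec-false (i FinP.<? j) i≮j)

split-by-order : (i j : Fin k) (a : ℤ) → a ≡ ifLess i j a + kron i j * a + ifLess j i a
split-by-order i j a with FinP.<-cmp i j
... | tri< i<j i≢j j≮i rewrite ifLess-yes a i<j | kron-≢ i≢j | ifLess-no a j≮i = upper a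
  where upper : ∀ a → a ≡ a + 0ℤ * a + 0ℤ
        upper = solve-∀
... | tri≈ i≮j refl j≮i rewrite ifLess-no a i≮j | kron-refl i = diagonal a
  where diagonal : ∀ a → a ≡ 0ℤ + 1ℤ * a + 0ℤ
        diagonal = solve-∀
... | tri> i≮j i≢j j<i rewrite ifLess-no a i≮j | kron-≢ i≢j | ifLess-yes a j<i = lower a
  where lower : ∀ a → a ≡ 0ℤ + 0ℤ * a + a
        lower = solve-∀

∑∑-symmetric : (g : Fin k → Fin k → ℤ) → (∀ i j → g i j ≡ g j i) →
  ∑[ i < k ] ∑[ j < k ] g i j ≡ ∑[ i < k ] g i i + + 2 * ∑[ i < k ] ∑[ j < k ] ifLess i j (g i j)
∑∑-symmetric {k} g g-sym = begin
  ∑[ i < k ] ∑[ j < k ] g i j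
    ≡⟨ sum-cong-≗ (λ i → sum-cong-≗ (λ j → split-by-order i j (g i j))) ⟩
  ∑[ i < k ] ∑[ j < k ] (upper i j + diag i j + lower i j)
    ≡⟨ sum-cong-≗ (λ i → trans (∑-distrib-+ (λ j → upper i j + diag i j) (lower i))
                               (cong (_+ sum (lower i)) (∑-distrib-+ (upper i) (diag i)))) ⟩
  ∑[ i < k ] (sum (upper i) + sum (diag i) + sum (lower i))
    ≡⟨ trans (∑-distrib-+ (λ i → sum (upper i) + sum (diag i)) (λ i → sum (lower i)))
             (cong (_+ ∑[ i < k ] sum (lower i)) (∑-distrib-+ (λ i → sum (upper i)) (λ i → sum (diag i)))) ⟩
  ∑U + ∑[ i < k ] sum (diag i) + ∑[ i < k ] sum (lower i)
    ≡⟨ cong₂ (λ d l → ∑U + d + l) (sum-cong-≗ (λ i → ∑-kron i (g i))) lower≡upper ⟩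
  ∑U + ∑[ i < k ] g i i + ∑U
    ≡⟨ regroup ∑U (∑[ i < k ] g i i) ⟩
  ∑[ i < k ] g i i + + 2 * ∑U ∎
  where
  open ≡-Reasoning
  upper diag lower : Fin k → Fin k → ℤ
  upper i j = ifLess i j (g i j)
  diag i j = kron i j * g i j
  lower i j = ifLess j i (g i j)
  ∑U = ∑[ i < k ] sum (upper i)
  lower≡upper : ∑[ i < k ] sum (lower i) ≡ ∑U
  lower≡upper = trans (∑-comm lower) (sum-cong-≗ (λ j → sum-cong-≗ (λ i → cong (ifLess j i) (g-sym i j))))
  regroup : ∀ u d → u + d + u ≡ d + + 2 * u
  regroup = solve-∀

-- Integer vectors

vec-ext : {x y : Vec ℤ k} → (∀ i → lookup x i ≡ lookup y i) → x ≡ y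
vec-ext {x = x} {y} x≗y = trans (sym (VecP.tabulate∘lookup x)) (trans (VecP.tabulate-cong x≗y) (VecP.tabulate∘lookup y))

nonzero-entry : (x : Vec ℤ k) → x ≢ replicate k 0ℤ → ∃ λ i → lookup x i ≢ 0ℤ
nonzero-entry {k} x x≢0 = FinP.¬∀⟶∃¬ k (λ i → lookup x i ≡ 0ℤ) (λ i → lookup x i ℤ.≟ 0ℤ)
  (λ x≗0 → x≢0 (vec-ext (λ i → trans (x≗0 i) (sym (VecP.lookup-replicate i 0ℤ)))))

lookup-updateAt-sub : (x : Vec ℤ k) (i j : Fin k) (c : ℤ) → lookup (x [ i ]%= (_- c)) j ≡ lookup x j - c * kron i j
lookup-updateAt-sub x i j c with i Fin.≟ j
... | yes refl = trans (lookup∘updateAt i x) (cong (λ a → lookup x i - a) (sym (ℤP.*-identityʳ c)))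
... | no i≢j = trans (lookup∘updateAt′ j i (i≢j ∘ sym) x) (sym (trans (cong (λ a → lookup x j - a) (ℤP.*-zeroʳ c)) (ℤP.+-identityʳ _)))

∥_∥₁ : Vec ℤ k → ℕ
∥ x ∥₁ = ℕΣ.sum (λ i → ℤ.∣ lookup x i ∣)

∑ℕ-suc-at : (f g : Fin k → ℕ) (i : Fin k) → (∀ j → j ≢ i → f j ≡ g j) → suc (f i) ≡ g i →
  suc (ℕΣ.sum f) ≡ ℕΣ.sum g
∑ℕ-suc-at f g zero f≡g sfᵢ≡gᵢ =
  cong₂ ℕ._+_ sfᵢ≡gᵢ (ℕΣ.sum-cong-≗ (λ j → f≡g (suc j) (λ ())))
∑ℕ-suc-at f g (suc i) f≡g sfᵢ≡gᵢ = trans (sym (ℕP.+-suc (f zero) _)) (cong₂ ℕ._+_ (f≡g zero (λ ()))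
  (∑ℕ-suc-at (λ j → f (suc j)) (λ j → g (suc j)) i (λ j j≢i → f≡g (suc j) (λ eq → j≢i (FinP.suc-injective eq))) sfᵢ≡gᵢ))

suc∣a-c∣≡∣a∣ : ∀ a {c} → IsUnit c → 0ℤ < c * a → suc ℤ.∣ a - c ∣ ≡ ℤ.∣ a ∣
suc∣a-c∣≡∣a∣ (+ suc n) (inj₁ refl) _ = refl
suc∣a-c∣≡∣a∣ -[1+ 0 ] (inj₂ refl) _ = refl
suc∣a-c∣≡∣a∣ -[1+ suc n ] (inj₂ refl) _ = refl
suc∣a-c∣≡∣a∣ (+ 0) (inj₁ refl) (+<+ ())
suc∣a-c∣≡∣a∣ -[1+ n ] (inj₁ refl) ()
suc∣a-c∣≡∣a∣ (+ 0) (inj₂ refl) (+<+ ())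
suc∣a-c∣≡∣a∣ (+ suc n) (inj₂ refl) ()

∥∥₁-unit-step : (x : Vec ℤ k) (i : Fin k) {c : ℤ} → IsUnit c → 0ℤ < c * lookup x i →
  suc ∥ x [ i ]%= (_- c) ∥₁ ≡ ∥ x ∥₁
∥∥₁-unit-step x i {c} c-unit 0<cxᵢ = ∑ℕ-suc-at (λ j → ℤ.∣ lookup (x [ i ]%= (_- c)) j ∣) (λ j → ℤ.∣ lookup x j ∣) i
  (λ j j≢i → cong ℤ.∣_∣ (lookup∘updateAt′ j i j≢i x))
  (trans (cong (λ a → suc ℤ.∣ a ∣) (lookup∘updateAt i x)) (suc∣a-c∣≡∣a∣ (lookup x i) c-unit 0<cxᵢ))

unique-⊆⇒length≤ : {A : Set} → DecidableEquality A → {xs ys : List A} →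
  Unique xs → xs ⊆ ys → length xs ℕ.≤ length ys
unique-⊆⇒length≤ _≟_ {[]} _ _ = z≤n
unique-⊆⇒length≤ _≟_ {x ∷ xs} {ys} (x∉xs ∷ xs-unique) x∷xs⊆ys = ℕP.≤-trans
  (s≤s (unique-⊆⇒length≤ _≟_ xs-unique xs⊆ys-x))
  (filter-notAll (λ y → ¬? (x ≟ y)) ys (Any.map (λ x≡y x≢y → x≢y x≡y) (x∷xs⊆ys (here refl))))
  where
  xs⊆ys-x : xs ⊆ filter (λ y → ¬? (x ≟ y)) ys
  xs⊆ys-x y∈xs = ∈-filter⁺ (λ y → ¬? (x ≟ y)) (x∷xs⊆ys (there y∈xs)) (All.lookup x∉xs y∈xs)

multiple∉ : (ys : List ℤ) (a : ℤ) → a ≢ 0ℤ → ∃ λ (k : ℕ) → + k * a ∉ ys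
multiple∉ ys a a≢0 = suc M , λ ka∈ys → ℕP.<-irrefl refl
  (ℕP.≤-trans (s≤s (All.lookup (f[xs]≤f[argmax] {f = ℤ.∣_∣} 0ℤ ys) ka∈ys)) (|ka|≥k ))
  where
  M = ℤ.∣ argmax ℤ.∣_∣ 0ℤ ys ∣
  |ka|≥k : suc M ℕ.≤ ℤ.∣ + suc M * a ∣
  |ka|≥k rewrite ℤP.abs-* (+ suc M) a = ℕP.m≤m*n (suc M) ℤ.∣ a ∣ {{ℕ.≢-nonZero (a≢0 ∘ ℤP.∣i∣≡0⇒i≡0)}}

finite⇒¬progression : ∀ {n} {P : Vec ℤ n → Set} → FiniteSet P → (f : ℕ → Vec ℤ n) → (∀ k → P (f k)) →
  ∀ j c a → a ≢ 0ℤ → (∀ k → lookup (f k) j ≡ c + + k * a) → ⊥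
finite⇒¬progression (L , P⊆L) f Pf j c a a≢0 fⱼ≡ with multiple∉ (List.map (λ y → lookup y j - c) L) a a≢0
... | k , ka∉L = ka∉L (subst (_∈ List.map (λ y → lookup y j - c) L) (shift (lookup (f k) j) (fⱼ≡ k))
                                (∈-map⁺ (λ y → lookup y j - c) (P⊆L (f k) (Pf k))))
  where
  shift : ∀ y → y ≡ c + + k * a → y - c ≡ + k * a
  shift y refl = solve c (+ k * a)
    where solve : ∀ c b → c + b - c ≡ b
          solve = solve-∀

-- d(v, i) as a function of [u = v], [u′ = v] and the signs ε, ε′ of the arrow; dArr B v i unfolds
-- to it, so the case analysis below is over Booleans and signs only.

arrowDir : (at₁ at₂ : Bool) (ε ε′ : Sign) → ℤ
arrowDir at₁ at₂ ε ε′ =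
  if at₁ ∧ at₂ ∧ not (does (ε SignP.≟ ε′)) then 1ℤ
  else if has Sgn.+ ∧ not (has Sgn.-) then 1ℤ
  else if has Sgn.- ∧ not (has Sgn.+) then -1ℤ
  else 0ℤ
  where
  has : Sign → Bool
  has d = (at₁ ∧ does (ε SignP.≟ d)) ∨ (at₂ ∧ does (ε′ SignP.≟ d))

arrowDir-first : ∀ ε ε′ → arrowDir true false ε ε′ ≡ signℤ ε
arrowDir-first Sgn.+ ε′ = refl
arrowDir-first Sgn.- ε′ = refl

arrowDir-second : ∀ ε ε′ → arrowDir false true ε ε′ ≡ signℤ ε′
arrowDir-second ε Sgn.+ = refl
arrowDir-second ε Sgn.- = refl

arrowDir-loop-unit : ∀ ε ε′ → IsUnit (arrowDir true true ε ε′)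
arrowDir-loop-unit Sgn.+ Sgn.+ = inj₁ refl
arrowDir-loop-unit Sgn.+ Sgn.- = inj₁ refl
arrowDir-loop-unit Sgn.- Sgn.+ = inj₁ refl
arrowDir-loop-unit Sgn.- Sgn.- = inj₂ refl

arrowDir-loop : ∀ ε ε′ → arrowDir true true ε ε′ * (signℤ ε + signℤ ε′) ≡ 1ℤ + signℤ ε * signℤ ε′
arrowDir-loop Sgn.+ Sgn.+ = refl
arrowDir-loop Sgn.+ Sgn.- = refl
arrowDir-loop Sgn.- Sgn.+ = refl
arrowDir-loop Sgn.- Sgn.- = refl

inverse-loop : ∀ ε ε′ → ε ≢ ε′ → -1ℤ * (signℤ ε + signℤ ε′) ≡ 1ℤ + signℤ ε * signℤ ε′
inverse-loop Sgn.+ Sgn.+ ε≢ε′ = ⊥-elim (ε≢ε′ refl)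
inverse-loop Sgn.+ Sgn.- _ = refl
inverse-loop Sgn.- Sgn.+ _ = refl
inverse-loop Sgn.- Sgn.- ε≢ε′ = ⊥-elim (ε≢ε′ refl)

-- The two shapes of the identity d(v, i) Iᵀeᵢ = e_v - σ(i) e_w, for a proper arrow and for a loop.

step-identity : ∀ s t δ δ′ → s * s ≡ 1ℤ → s * (s * δ + t * δ′) ≡ δ - (- (s * t)) * δ′
step-identity s t δ δ′ s²≡1 = begin
  s * (s * δ + t * δ′)   ≡⟨ expand s t δ δ′ ⟩
  s * s * δ + s * t * δ′ ≡⟨ cong (λ a → a * δ + s * t * δ′) s²≡1 ⟩
  1ℤ * δ + s * t * δ′    ≡⟨ collect s t δ δ′ ⟩
  δ - (- (s * t)) * δ′ ∎
  where
  open ≡-Reasoning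
  expand : ∀ s t δ δ′ → s * (s * δ + t * δ′) ≡ s * s * δ + s * t * δ′
  expand = solve-∀
  collect : ∀ s t δ δ′ → 1ℤ * δ + s * t * δ′ ≡ δ - (- (s * t)) * δ′
  collect = solve-∀

step-identity-loop : ∀ d s t δ → d * (s + t) ≡ 1ℤ + s * t → d * (s * δ + t * δ) ≡ δ - (- (s * t)) * δ
step-identity-loop d s t δ eq = begin
  d * (s * δ + t * δ) ≡⟨ factor d s t δ ⟩
  d * (s + t) * δ     ≡⟨ cong (_* δ) eq ⟩
  (1ℤ + s * t) * δ    ≡⟨ unfactor s t δ ⟩
  δ - (- (s * t)) * δ ∎
  where
  open ≡-Reasoning
  factor : ∀ d s t δ → d * (s * δ + t * δ) ≡ d * (s + t) * δ
  factor = solve-∀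
  unfactor : ∀ s t δ → (1ℤ + s * t) * δ ≡ δ - (- (s * t)) * δ
  unfactor = solve-∀

module _ {m n : ℕ} (B : BiGraph m n) where

  -- The Gram identity 2 q(x) = ‖Iᵀ x‖²

  Iᵀ : Vec ℤ n → Fin m → ℤ
  Iᵀ x v = ∑[ i < n ] (lookup x i * col B i v)

  qOff≡∑ : ∀ i j → qOff B i j ≡ ∑[ v < m ] (col B i v * col B j v)
  qOff≡∑ i j = sumFin≡sum (λ v → col B i v * col B j v)

  pairSign : Fin n → ℤ
  pairSign i = signℤ (ε₁ B i) * signℤ (ε₂ B i)

  col-sq : ∀ i v → col B i v * col B i v ≡
    kron (u₁ B i) v + kron (u₂ B i) v + + 2 * (pairSign i * (kron (u₁ B i) v * kron (u₂ B i) v))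
  col-sq i v = begin
    (s₁ * δ₁ + s₂ * δ₂) * (s₁ * δ₁ + s₂ * δ₂)
      ≡⟨ expand s₁ s₂ δ₁ δ₂ ⟩
    s₁ * s₁ * (δ₁ * δ₁) + s₂ * s₂ * (δ₂ * δ₂) + + 2 * (s₁ * s₂ * (δ₁ * δ₂))
      ≡⟨ cong₂ (λ a b → a + b + + 2 * (s₁ * s₂ * (δ₁ * δ₂)))
           (cong₂ _*_ (unit-sq (signℤ-unit (ε₁ B i))) (kron-sq (u₁ B i) v))
           (cong₂ _*_ (unit-sq (signℤ-unit (ε₂ B i))) (kron-sq (u₂ B i) v)) ⟩
    1ℤ * δ₁ + 1ℤ * δ₂ + + 2 * (s₁ * s₂ * (δ₁ * δ₂))
      ≡⟨ cong₂ (λ a b → a + b + + 2 * (s₁ * s₂ * (δ₁ * δ₂))) (ℤP.*-identityˡ δ₁) (ℤP.*-identityˡ δ₂) ⟩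
    δ₁ + δ₂ + + 2 * (s₁ * s₂ * (δ₁ * δ₂)) ∎
    where
    open ≡-Reasoning
    s₁ = signℤ (ε₁ B i)
    s₂ = signℤ (ε₂ B i)
    δ₁ = kron (u₁ B i) v
    δ₂ = kron (u₂ B i) v
    expand : ∀ s₁ s₂ δ₁ δ₂ → (s₁ * δ₁ + s₂ * δ₂) * (s₁ * δ₁ + s₂ * δ₂) ≡
      s₁ * s₁ * (δ₁ * δ₁) + s₂ * s₂ * (δ₂ * δ₂) + + 2 * (s₁ * s₂ * (δ₁ * δ₂))
    expand = solve-∀

  selfPairing : Fin n → ℤ
  selfPairing i = 1ℤ + pairSign i * kron (u₁ B i) (u₂ B i)

  qOff-diag : ∀ i → qOff B i i ≡ + 2 * selfPairing i
  qOff-diag i = begin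
    qOff B i i
      ≡⟨ trans (qOff≡∑ i i) (sum-cong-≗ (col-sq i)) ⟩
    ∑[ v < m ] (δ₁ v + δ₂ v + + 2 * cross v)
      ≡⟨ trans (∑-distrib-+ (λ v → δ₁ v + δ₂ v) (λ v → + 2 * cross v))
               (cong₂ _+_ (∑-distrib-+ δ₁ δ₂) (sym (*-distribˡ-sum (+ 2) cross))) ⟩
    sum δ₁ + sum δ₂ + + 2 * sum cross
      ≡⟨ cong₂ (λ a b → a + b + + 2 * sum cross) (∑-kron-1 (u₁ B i)) (∑-kron-1 (u₂ B i)) ⟩
    1ℤ + 1ℤ + + 2 * sum cross
      ≡⟨ cong (λ a → 1ℤ + 1ℤ + + 2 * a) (trans (sym (*-distribˡ-sum (pairSign i) (λ v → δ₁ v * δ₂ v)))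
                                              (cong (pairSign i *_) (∑-kron (u₁ B i) δ₂))) ⟩
    1ℤ + 1ℤ + + 2 * (pairSign i * kron (u₂ B i) (u₁ B i))
      ≡⟨ cong (λ a → 1ℤ + 1ℤ + + 2 * (pairSign i * a)) (kron-sym (u₂ B i) (u₁ B i)) ⟩
    1ℤ + 1ℤ + + 2 * (pairSign i * kron (u₁ B i) (u₂ B i))
      ≡⟨ factor (pairSign i * kron (u₁ B i) (u₂ B i)) ⟩
    + 2 * selfPairing i ∎
    where
    open ≡-Reasoning
    δ₁ δ₂ cross : Fin m → ℤ
    δ₁ = kron (u₁ B i)
    δ₂ = kron (u₂ B i)
    cross v = pairSign i * (δ₁ v * δ₂ v)
    ∑-kron-1 : ∀ u → sum (kron u) ≡ 1ℤ
    ∑-kron-1 u = trans (sum-cong-≗ (λ v → sym (ℤP.*-identityʳ (kron u v)))) (∑-kron u (λ _ → 1ℤ))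
    factor : ∀ a → 1ℤ + 1ℤ + + 2 * a ≡ + 2 * (1ℤ + a)
    factor = solve-∀

  pairSign-unit : ∀ i → IsUnit (pairSign i)
  pairSign-unit i = unit-* (signℤ-unit (ε₁ B i)) (signℤ-unit (ε₂ B i))

  qDiag≡selfPairing : ∀ i → qDiag B i ≡ selfPairing i
  qDiag≡selfPairing i = begin
    + (ℤ.∣ qOff B i i ∣ ℕ./ 2)        ≡⟨ cong (λ a → + (ℤ.∣ a ∣ ℕ./ 2)) (qOff-diag i) ⟩
    + (ℤ.∣ + 2 * z ∣ ℕ./ 2)           ≡⟨ cong (λ a → + (a ℕ./ 2)) (trans (ℤP.abs-* (+ 2) z) (ℕP.*-comm 2 ℤ.∣ z ∣)) ⟩
    + (ℤ.∣ z ∣ ℕ.* 2 ℕ./ 2)           ≡⟨ cong +_ (m*n/n≡m ℤ.∣ z ∣ 2) ⟩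
    + ℤ.∣ z ∣                          ≡⟨ ℤP.0≤i⇒+∣i∣≡i (unit-kron-nonneg (pairSign-unit i) (u₁ B i) (u₂ B i)) ⟩
    z ∎
    where
    open ≡-Reasoning
    z = selfPairing i

  qDiag*2≡qOff : ∀ i → qDiag B i * + 2 ≡ qOff B i i
  qDiag*2≡qOff i = trans (cong (_* + 2) (qDiag≡selfPairing i)) (trans (ℤP.*-comm _ (+ 2)) (sym (qOff-diag i)))

  q-Gram : ∀ x → q B x * + 2 ≡ sumSq (Iᵀ x)
  q-Gram x = begin
    q B x * + 2
      ≡⟨ cong (_* + 2) (cong₂ _+_ (sumFin≡sum D) (trans (sumFin≡sum (λ i → sumFin (U i))) (sum-cong-≗ (λ i → sumFin≡sum (U i))))) ⟩
    (sum D + ∑[ i < n ] sum (U i)) * + 2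
      ≡⟨ distrib (sum D) (∑[ i < n ] sum (U i)) ⟩
    + 2 * sum D + + 2 * ∑[ i < n ] sum (U i)
      ≡⟨ cong (_+ + 2 * ∑[ i < n ] sum (U i)) (trans (*-distribˡ-sum (+ 2) D) (sum-cong-≗ diagonal)) ⟩
    ∑[ i < n ] g i i + + 2 * ∑[ i < n ] sum (U i)
      ≡⟨ sym (∑∑-symmetric g g-sym) ⟩
    ∑[ i < n ] ∑[ j < n ] g i j
      ≡⟨ sum-cong-≗ (λ i → sum-cong-≗ (λ j → trans (ℤP.*-comm (qOff B i j) _) (cong (x̂ i * x̂ j *_) (qOff≡∑ i j)))) ⟩
    ∑[ i < n ] ∑[ j < n ] (x̂ i * x̂ j * ∑[ v < m ] (col B i v * col B j v))
      ≡⟨ sym (sumSq-linear x̂ (col B)) ⟩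
    sumSq (Iᵀ x) ∎
    where
    open ≡-Reasoning
    x̂ : Fin n → ℤ
    x̂ = lookup x
    g : Fin n → Fin n → ℤ
    g i j = qOff B i j * (x̂ i * x̂ j)
    g-sym : ∀ i j → g i j ≡ g j i
    g-sym i j = cong₂ _*_ (trans (qOff≡∑ i j) (trans (sum-cong-≗ (λ v → ℤP.*-comm (col B i v) (col B j v))) (sym (qOff≡∑ j i))))
                          (ℤP.*-comm (x̂ i) (x̂ j))
    D : Fin n → ℤ
    D i = qDiag B i * (x̂ i * x̂ i)
    U : Fin n → Fin n → ℤ
    U i j = ifLess i j (g i j)
    diagonal : ∀ i → + 2 * D i ≡ g i i
    diagonal i = trans (sym (ℤP.*-assoc (+ 2) (qDiag B i) _))
                       (cong (_* (x̂ i * x̂ i)) (trans (ℤP.*-comm (+ 2) (qDiag B i)) (qDiag*2≡qOff i)))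
    distrib : ∀ a b → (a + b) * + 2 ≡ + 2 * a + + 2 * b
    distrib = solve-∀

  q-nonneg : ∀ x → 0ℤ ≤ q B x
  q-nonneg x = ℤP.*-cancelʳ-≤-pos 0ℤ (q B x) (+ 2) (subst (0ℤ ≤_) (sym (q-Gram x)) (sumSq-nonneg (Iᵀ x)))

  q≡0⇒Iᵀ≡0 : ∀ x → q B x ≡ 0ℤ → ∀ v → Iᵀ x v ≡ 0ℤ
  q≡0⇒Iᵀ≡0 x q≡0 = sumSq≡0 (Iᵀ x) (trans (sym (q-Gram x)) (cong (_* + 2) q≡0))

  q≯0⇒Iᵀ≡0 : ∀ x → ¬ 0ℤ < q B x → ∀ v → Iᵀ x v ≡ 0ℤ
  q≯0⇒Iᵀ≡0 x q≯0 = q≡0⇒Iᵀ≡0 x (ℤP.≤-antisym (ℤP.≮⇒≥ q≯0) (q-nonneg x))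

  Iᵀ≡0⇒q≡0 : ∀ x → (∀ v → Iᵀ x v ≡ 0ℤ) → q B x ≡ 0ℤ
  Iᵀ≡0⇒q≡0 x Iᵀx≡0 = ℤP.*-cancelʳ-≡ (q B x) 0ℤ (+ 2)
    (trans (q-Gram x) (trans (sum-cong-≗ (λ v → cong (λ a → a * a) (Iᵀx≡0 v))) (sum-replicate-zero m)))

  Iᵀ≡col⇒q≡qDiag : ∀ x i → (∀ v → Iᵀ x v ≡ col B i v) → q B x ≡ qDiag B i
  Iᵀ≡col⇒q≡qDiag x i Iᵀx≡colᵢ = ℤP.*-cancelʳ-≡ (q B x) (qDiag B i) (+ 2)
    (trans (q-Gram x) (trans (sum-cong-≗ (λ v → cong (λ a → a * a) (Iᵀx≡colᵢ v)))
                             (sym (trans (qDiag*2≡qOff i) (qOff≡∑ i i)))))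

  positive⇒ker≡0 : Positive B → ∀ x → (∀ v → Iᵀ x v ≡ 0ℤ) → x ≡ replicate n 0ℤ
  positive⇒ker≡0 pos x Iᵀx≡0 with VecP.≡-dec ℤ._≟_ x (replicate n 0ℤ)
  ... | yes x≡0 = x≡0
  ... | no x≢0 = ⊥-elim (ℤP.<-irrefl (sym (Iᵀ≡0⇒q≡0 x Iᵀx≡0)) (pos x x≢0))

  Iᵀ-+ : ∀ x y v → Iᵀ (_+ᵥ_ B x y) v ≡ Iᵀ x v + Iᵀ y v
  Iᵀ-+ x y v = trans
    (sum-cong-≗ (λ i → trans (cong (_* col B i v) (VecP.lookup-zipWith _+_ i x y))
                             (ℤP.*-distribʳ-+ (col B i v) (lookup x i) (lookup y i))))
    (∑-distrib-+ (λ i → lookup x i * col B i v) (λ i → lookup y i * col B i v))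

  Iᵀ-· : ∀ a x v → Iᵀ (_·ᵥ_ B a x) v ≡ a * Iᵀ x v
  Iᵀ-· a x v = trans
    (sum-cong-≗ (λ i → trans (cong (_* col B i v) (VecP.lookup-map i (a *_) x)) (ℤP.*-assoc a (lookup x i) (col B i v))))
    (sym (*-distribˡ-sum a (λ i → lookup x i * col B i v)))

  Iᵀ-neg : ∀ x v → Iᵀ (-ᵥ_ B x) v ≡ - Iᵀ x v
  Iᵀ-neg x v = trans
    (sum-cong-≗ (λ i → trans (cong (_* col B i v) (trans (VecP.lookup-map i -_ x) (sym (ℤP.-1*i≡-i (lookup x i)))))
                             (ℤP.*-assoc -1ℤ (lookup x i) (col B i v))))
    (trans (sym (*-distribˡ-sum -1ℤ (λ i → lookup x i * col B i v))) (ℤP.-1*i≡-i (Iᵀ x v)))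

  Iᵀ-e : ∀ j v → Iᵀ (e B j) v ≡ col B j v
  Iᵀ-e j v = trans (sum-cong-≗ (λ i → cong (_* col B i v) (VecP.lookup∘tabulate (kron j) i)))
                   (∑-kron j (λ i → col B i v))

  Iᵀ-0 : ∀ v → Iᵀ (replicate n 0ℤ) v ≡ 0ℤ
  Iᵀ-0 v = trans (sum-cong-≗ (λ i → trans (cong (_* col B i v) (VecP.lookup-replicate i 0ℤ)) (ℤP.*-zeroˡ (col B i v))))
                 (sum-replicate-zero n)

  Iᵀ-updateAt-sub : ∀ x i c v → Iᵀ (x [ i ]%= (_- c)) v ≡ Iᵀ x v - c * col B i v
  Iᵀ-updateAt-sub x i c v = begin
    ∑[ j < n ] (lookup (x [ i ]%= (_- c)) j * col B j v)
      ≡⟨ sum-cong-≗ (λ j → trans (cong (_* col B j v) (lookup-updateAt-sub x i j c))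
                                 (spread (lookup x j) c (kron i j) (col B j v))) ⟩
    ∑[ j < n ] (lookup x j * col B j v + - c * (kron i j * col B j v))
      ≡⟨ ∑-distrib-+ (λ j → lookup x j * col B j v) (λ j → - c * (kron i j * col B j v)) ⟩
    Iᵀ x v + ∑[ j < n ] (- c * (kron i j * col B j v))
      ≡⟨ cong (λ a → Iᵀ x v + a) (trans (sym (*-distribˡ-sum (- c) (λ j → kron i j * col B j v))) (cong (- c *_) (∑-kron i (λ j → col B j v)))) ⟩
    Iᵀ x v + - c * col B i v
      ≡⟨ collect (Iᵀ x v) c (col B i v) ⟩
    Iᵀ x v - c * col B i v ∎
    where
    open ≡-Reasoning
    spread : ∀ a c δ p → (a - c * δ) * p ≡ a * p + - c * (δ * p)
    spread = solve-∀
    collect : ∀ a c p → a + - c * p ≡ a - c * p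
    collect = solve-∀

  positive⇒Iᵀ-injective : Positive B → ∀ x y → (∀ v → Iᵀ x v ≡ Iᵀ y v) → x ≡ y
  positive⇒Iᵀ-injective pos x y Iᵀx≡Iᵀy = vec-ext λ i → ℤP.i-j≡0⇒i≡j (lookup x i) (lookup y i)
    (trans (cong (λ a → lookup x i + a) (sym (VecP.lookup-map i -_ y)))
      (trans (sym (VecP.lookup-zipWith _+_ i x (-ᵥ_ B y)))
        (trans (cong (λ z → lookup z i) x-y≡0) (VecP.lookup-replicate i 0ℤ))))
    where
    x-y≡0 : _+ᵥ_ B x (-ᵥ_ B y) ≡ replicate n 0ℤ
    x-y≡0 = positive⇒ker≡0 pos _ λ v → trans (Iᵀ-+ x (-ᵥ_ B y) v)
              (trans (cong₂ (λ a b → a + b) (Iᵀx≡Iᵀy v) (Iᵀ-neg y v)) (ℤP.+-inverseʳ (Iᵀ y v)))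

  dArr-first : ∀ i → dArr B (u₁ B i) i ≡ arrowDir true (eqV B (u₂ B i) (u₁ B i)) (ε₁ B i) (ε₂ B i)
  dArr-first i = cong (λ b → arrowDir b (eqV B (u₂ B i) (u₁ B i)) (ε₁ B i) (ε₂ B i)) (dec-true (u₁ B i Fin.≟ u₁ B i) refl)

  dArr-second : ∀ i → dArr B (u₂ B i) i ≡ arrowDir (eqV B (u₁ B i) (u₂ B i)) true (ε₁ B i) (ε₂ B i)
  dArr-second i = cong (λ b → arrowDir (eqV B (u₁ B i) (u₂ B i)) b (ε₁ B i) (ε₂ B i)) (dec-true (u₂ B i Fin.≟ u₂ B i) refl)

  dArr-proper₁ : ∀ i → u₁ B i ≢ u₂ B i → dArr B (u₁ B i) i ≡ signℤ (ε₁ B i)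
  dArr-proper₁ i proper = trans (dArr-first i) (trans
    (cong (λ b → arrowDir true b (ε₁ B i) (ε₂ B i)) (dec-false (u₂ B i Fin.≟ u₁ B i) (proper ∘ sym)))
    (arrowDir-first (ε₁ B i) (ε₂ B i)))

  dArr-proper₂ : ∀ i → u₁ B i ≢ u₂ B i → dArr B (u₂ B i) i ≡ signℤ (ε₂ B i)
  dArr-proper₂ i proper = trans (dArr-second i) (trans
    (cong (λ b → arrowDir b true (ε₁ B i) (ε₂ B i)) (dec-false (u₁ B i Fin.≟ u₂ B i) proper))
    (arrowDir-second (ε₁ B i) (ε₂ B i)))

  dArr-loop₁ : ∀ i → u₁ B i ≡ u₂ B i → dArr B (u₁ B i) i ≡ arrowDir true true (ε₁ B i) (ε₂ B i)
  dArr-loop₁ i loop = trans (dArr-first i)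
    (cong (λ b → arrowDir true b (ε₁ B i) (ε₂ B i)) (dec-true (u₂ B i Fin.≟ u₁ B i) (sym loop)))

  dArr-loop₂ : ∀ i → u₁ B i ≡ u₂ B i → dArr B (u₂ B i) i ≡ arrowDir true true (ε₁ B i) (ε₂ B i)
  dArr-loop₂ i loop = trans (dArr-second i)
    (cong (λ b → arrowDir b true (ε₁ B i) (ε₂ B i)) (dec-true (u₁ B i Fin.≟ u₂ B i) loop))

  -- At v = u₂ the test is u₂ ≟ u₁: the term u₁ ≟ u₂ occurs inside dArr B u₂ i and would be
  -- captured by the with-abstraction.
  step-unit : ∀ {v w} i → Joins B v (fwd i) w → IsUnit (dArr B v i)
  step-unit i (inj₁ (refl , _)) with u₁ B i Fin.≟ u₂ B i
  ... | yes loop = subst IsUnit (sym (dArr-loop₁ i loop)) (arrowDir-loop-unit (ε₁ B i) (ε₂ B i))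
  ... | no proper = subst IsUnit (sym (dArr-proper₁ i proper)) (signℤ-unit (ε₁ B i))
  step-unit i (inj₂ (refl , _)) with u₂ B i Fin.≟ u₁ B i
  ... | yes loop = subst IsUnit (sym (dArr-loop₂ i (sym loop))) (arrowDir-loop-unit (ε₁ B i) (ε₂ B i))
  ... | no proper = subst IsUnit (sym (dArr-proper₂ i (proper ∘ sym))) (signℤ-unit (ε₂ B i))

  loop-col : ∀ i d {v w} → u₁ B i ≡ v → u₂ B i ≡ v → w ≡ v →
    d * (signℤ (ε₁ B i) + signℤ (ε₂ B i)) ≡ 1ℤ + pairSign i →
    ∀ u → d * col B i u ≡ kron v u - σ B (fwd i) * kron w u
  loop-col i d refl u₂≡u₁ refl d-eq u = begin
    d * (s₁ * kron (u₁ B i) u + s₂ * kron (u₂ B i) u)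
      ≡⟨ cong (λ a → d * (s₁ * kron (u₁ B i) u + s₂ * kron a u)) u₂≡u₁ ⟩
    d * (s₁ * kron (u₁ B i) u + s₂ * kron (u₁ B i) u)
      ≡⟨ step-identity-loop d s₁ s₂ (kron (u₁ B i) u) d-eq ⟩
    kron (u₁ B i) u - σ B (fwd i) * kron (u₁ B i) u ∎
    where
    open ≡-Reasoning
    s₁ = signℤ (ε₁ B i)
    s₂ = signℤ (ε₂ B i)

  step-col : ∀ {v w} s → Joins B v s w → ∀ u →
    dStep B v s * col B (arrowOf B s) u ≡ kron v u - σ B s * kron w u
  step-col (fwd i) (inj₁ (refl , refl)) u with u₁ B i Fin.≟ u₂ B i
  ... | yes loop = loop-col i (dArr B (u₁ B i) i) refl (sym loop) (sym loop)
                     (trans (cong (_* (signℤ (ε₁ B i) + signℤ (ε₂ B i))) (dArr-loop₁ i loop)) (arrowDir-loop (ε₁ B i) (ε₂ B i))) u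
  ... | no proper = trans (cong (_* col B i u) (dArr-proper₁ i proper))
                      (step-identity (signℤ (ε₁ B i)) (signℤ (ε₂ B i)) _ _ (unit-sq (signℤ-unit (ε₁ B i))))
  step-col (fwd i) (inj₂ (refl , refl)) u with u₂ B i Fin.≟ u₁ B i
  ... | yes loop = loop-col i (dArr B (u₂ B i) i) (sym loop) refl (sym loop)
                     (trans (cong (_* (signℤ (ε₁ B i) + signℤ (ε₂ B i))) (dArr-loop₂ i (sym loop))) (arrowDir-loop (ε₁ B i) (ε₂ B i))) u
  ... | no proper = begin
    dArr B (u₂ B i) i * (s₁ * δ₁ + s₂ * δ₂) ≡⟨ cong₂ _*_ (dArr-proper₂ i (proper ∘ sym)) (ℤP.+-comm (s₁ * δ₁) (s₂ * δ₂)) ⟩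
    s₂ * (s₂ * δ₂ + s₁ * δ₁)               ≡⟨ step-identity s₂ s₁ δ₂ δ₁ (unit-sq (signℤ-unit (ε₂ B i))) ⟩
    δ₂ - (- (s₂ * s₁)) * δ₁                 ≡⟨ cong (λ a → δ₂ - (- a) * δ₁) (ℤP.*-comm s₂ s₁) ⟩
    δ₂ - σ B (fwd i) * δ₁ ∎
    where
    open ≡-Reasoning
    s₁ = signℤ (ε₁ B i)
    s₂ = signℤ (ε₂ B i)
    δ₁ = kron (u₁ B i) u
    δ₂ = kron (u₂ B i) u
  step-col (inv i (loop , ε₁≢ε₂)) (inj₁ (refl , refl)) u =
    loop-col i -1ℤ refl (sym loop) (sym loop) (inverse-loop (ε₁ B i) (ε₂ B i) ε₁≢ε₂) u
  step-col (inv i (loop , ε₁≢ε₂)) (inj₂ (refl , refl)) u =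
    loop-col i -1ℤ loop refl loop (inverse-loop (ε₁ B i) (ε₂ B i) ε₁≢ε₂) u

  -- Walks

  target : ∀ {v} → Walk B v → Fin m
  target {v} [] = v
  target (_ ∷⟨ _ ⟩ ω) = target ω

  sign : ∀ {v} → Walk B v → ℤ
  sign [] = 1ℤ
  sign (s ∷⟨ _ ⟩ ω) = σ B s * sign ω

  len : ∀ {v} → Walk B v → ℕ
  len [] = 0
  len (_ ∷⟨ _ ⟩ ω) = suc (len ω)

  σ-unit : ∀ s → IsUnit (σ B s)
  σ-unit s = unit-neg (pairSign-unit (arrowOf B s))

  _++ʷ_ : ∀ {v} (ω : Walk B v) → Walk B (target ω) → Walk B v
  [] ++ʷ ω′ = ω′
  (s ∷⟨ j ⟩ ω) ++ʷ ω′ = s ∷⟨ j ⟩ (ω ++ʷ ω′)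

  lookup-incAux-[] : ∀ {v} acc i → lookup (incAux B acc {v} []) i ≡ 0ℤ
  lookup-incAux-[] acc i = VecP.lookup-replicate i 0ℤ

  lookup-incAux-∷ : ∀ {v w} acc s (j : Joins B v s w) ω i →
    lookup (incAux B acc (s ∷⟨ j ⟩ ω)) i ≡ acc * dStep B v s * kron (arrowOf B s) i + lookup (incAux B (acc * σ B s) ω) i
  lookup-incAux-∷ {v} acc s j ω i = trans
    (VecP.lookup-zipWith _+_ i (_·ᵥ_ B (acc * dStep B v s) (e B (arrowOf B s))) (incAux B (acc * σ B s) ω))
    (cong (_+ lookup (incAux B (acc * σ B s) ω) i)
      (trans (VecP.lookup-map i (acc * dStep B v s *_) (e B (arrowOf B s)))
             (cong (acc * dStep B v s *_) (VecP.lookup∘tabulate (kron (arrowOf B s)) i))))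

  incAux-scale : ∀ {v} a acc (ω : Walk B v) i → lookup (incAux B (a * acc) ω) i ≡ a * lookup (incAux B acc ω) i
  incAux-scale {v} a acc [] i = trans (lookup-incAux-[] {v} (a * acc) i) (sym (trans (cong (a *_) (lookup-incAux-[] {v} acc i)) (ℤP.*-zeroʳ a)))
  incAux-scale {v} a acc (s ∷⟨ j ⟩ ω) i = begin
    lookup (incAux B (a * acc) (s ∷⟨ j ⟩ ω)) i
      ≡⟨ lookup-incAux-∷ (a * acc) s j ω i ⟩
    a * acc * d * κ + lookup (incAux B (a * acc * σ B s) ω) i
      ≡⟨ cong (λ z → a * acc * d * κ + z) (trans (cong (λ c → lookup (incAux B c ω) i) (ℤP.*-assoc a acc (σ B s)))
                                                 (incAux-scale a (acc * σ B s) ω i)) ⟩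
    a * acc * d * κ + a * lookup (incAux B (acc * σ B s) ω) i
      ≡⟨ factor a acc d κ _ ⟩
    a * (acc * d * κ + lookup (incAux B (acc * σ B s) ω) i)
      ≡⟨ cong (a *_) (sym (lookup-incAux-∷ acc s j ω i)) ⟩
    a * lookup (incAux B acc (s ∷⟨ j ⟩ ω)) i ∎
    where
    open ≡-Reasoning
    d = dStep B v s
    κ = kron (arrowOf B s) i
    factor : ∀ a c d κ r → a * c * d * κ + a * r ≡ a * (c * d * κ + r)
    factor = solve-∀

  incAux-++ : ∀ {v} acc (ω : Walk B v) ω′ i →
    lookup (incAux B acc (ω ++ʷ ω′)) i ≡ lookup (incAux B acc ω) i + lookup (incAux B (acc * sign ω) ω′) i
  incAux-++ {v} acc [] ω′ i = sym (trans (cong₂ _+_ (lookup-incAux-[] {v} acc i) (cong (λ c → lookup (incAux B c ω′) i) (ℤP.*-identityʳ acc)))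
                                     (ℤP.+-identityˡ _))
  incAux-++ {v} acc (s ∷⟨ j ⟩ ω) ω′ i = begin
    lookup (incAux B acc (s ∷⟨ j ⟩ (ω ++ʷ ω′))) i
      ≡⟨ lookup-incAux-∷ acc s j (ω ++ʷ ω′) i ⟩
    c + lookup (incAux B (acc * σ B s) (ω ++ʷ ω′)) i
      ≡⟨ cong (λ z → c + z) (incAux-++ (acc * σ B s) ω ω′ i) ⟩
    c + (lookup (incAux B (acc * σ B s) ω) i + lookup (incAux B (acc * σ B s * sign ω) ω′) i)
      ≡⟨ sym (ℤP.+-assoc c _ _) ⟩
    c + lookup (incAux B (acc * σ B s) ω) i + lookup (incAux B (acc * σ B s * sign ω) ω′) i
      ≡⟨ cong₂ _+_ (sym (lookup-incAux-∷ acc s j ω i)) (cong (λ a → lookup (incAux B a ω′) i) (ℤP.*-assoc acc (σ B s) (sign ω))) ⟩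
    lookup (incAux B acc (s ∷⟨ j ⟩ ω)) i + lookup (incAux B (acc * (σ B s * sign ω)) ω′) i ∎
    where
    open ≡-Reasoning
    c = acc * dStep B v s * kron (arrowOf B s) i

  Iᵀ-incAux : ∀ {v} acc (ω : Walk B v) u → Iᵀ (incAux B acc ω) u ≡ acc * kron v u - acc * sign ω * kron (target ω) u
  Iᵀ-incAux {v} acc [] u = trans (Iᵀ-0 u) (cancel acc (kron v u))
    where cancel : ∀ a δ → 0ℤ ≡ a * δ - a * 1ℤ * δ
          cancel = solve-∀
  Iᵀ-incAux {v} acc (_∷⟨_⟩_ {w = w} s j ω) u = begin
    Iᵀ (_+ᵥ_ B (_·ᵥ_ B (acc * d) (e B i)) (incAux B (acc * σ B s) ω)) u
      ≡⟨ Iᵀ-+ (_·ᵥ_ B (acc * d) (e B i)) (incAux B (acc * σ B s) ω) u ⟩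
    Iᵀ (_·ᵥ_ B (acc * d) (e B i)) u + Iᵀ (incAux B (acc * σ B s) ω) u
      ≡⟨ cong₂ _+_ (trans (Iᵀ-· (acc * d) (e B i) u) (trans (cong (acc * d *_) (Iᵀ-e i u))
                     (trans (ℤP.*-assoc acc d (col B i u)) (cong (acc *_) (step-col s j u)))))
                   (Iᵀ-incAux (acc * σ B s) ω u) ⟩
    acc * (kron v u - σ B s * kron w u) + (acc * σ B s * kron w u - acc * σ B s * sign ω * kron (target ω) u)
      ≡⟨ telescope acc (kron v u) (σ B s) (kron w u) (sign ω) (kron (target ω) u) ⟩
    acc * kron v u - acc * (σ B s * sign ω) * kron (target ω) u ∎
    where
    open ≡-Reasoning
    d = dStep B v s
    i = arrowOf B s
    telescope : ∀ a δᵥ σ δ_w sgn δₜ → a * (δᵥ - σ * δ_w) + (a * σ * δ_w - a * σ * sgn * δₜ) ≡ a * δᵥ - a * (σ * sgn) * δₜ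
    telescope = solve-∀

  record Decomposition (x : Vec ℤ n) (a : Fin m) (s : ℤ) (b : Fin m) (t : ℤ) : Set where
    field
      walk : Walk B a
      ends : target walk ≡ b
      signs : s * sign walk ≡ t
      rest : Vec ℤ n
      splits : ∀ i → lookup x i ≡ lookup (incAux B s walk) i + lookup rest i
      rest-ker : ∀ u → Iᵀ rest u ≡ 0ℤ
      rest-small : ∥ rest ∥₁ ℕ.≤ ∥ x ∥₁

  col≢0⇒joins : ∀ i v → col B i v ≢ 0ℤ → Σ[ w ∈ Fin m ] Joins B v (fwd i) w
  col≢0⇒joins i v col≢0 with u₁ B i Fin.≟ v | u₂ B i Fin.≟ v
  ... | yes refl | _ = u₂ B i , inj₁ (refl , refl)
  ... | no _ | yes refl = u₁ B i , inj₂ (refl , refl)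
  ... | no _ | no _ = ⊥-elim (col≢0 (cong₂ _+_ (ℤP.*-zeroʳ (signℤ (ε₁ B i))) (ℤP.*-zeroʳ (signℤ (ε₂ B i)))))

  -- Since d(v,i) Iᵀeᵢ(v) = 1 - σ(i)[w = v] ≥ 0 and d(v,i)² = 1, a positive term s xᵢ Iᵀeᵢ(v)
  -- of s Iᵀx(v) forces s d(v,i) xᵢ > 0.
  OutgoingArrow : Vec ℤ n → Fin m → ℤ → Set
  OutgoingArrow x v s = Σ[ i ∈ Fin n ] Σ[ w ∈ Fin m ] Σ[ j ∈ Joins B v (fwd i) w ] 0ℤ < s * dArr B v i * lookup x i

  outgoing-arrow : ∀ x v s → 0ℤ < s * Iᵀ x v → OutgoingArrow x v s
  outgoing-arrow x v s 0<sIᵀx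
    with ∑-pos (λ i → s * (lookup x i * col B i v)) (subst (0ℤ <_) (*-distribˡ-sum s (λ i → lookup x i * col B i v)) 0<sIᵀx)
  ... | i , 0<term = i , w , j , ℤP.*-cancelʳ-<-nonNeg (d * c) {{ℤ.nonNegative dc≥0}} (subst (0ℤ <_) regroup 0<term)
    where
    c = col B i v
    c≢0 : c ≢ 0ℤ
    c≢0 c≡0 = ℤP.<-irrefl (sym (trans (cong (λ z → s * (lookup x i * z)) c≡0)
                                       (trans (cong (s *_) (ℤP.*-zeroʳ (lookup x i))) (ℤP.*-zeroʳ s)))) 0<term
    w = proj₁ (col≢0⇒joins i v c≢0)
    j = proj₂ (col≢0⇒joins i v c≢0)
    d = dArr B v i
    dc≥0 : 0ℤ ≤ d * c
    dc≥0 = subst (0ℤ ≤_) (sym (trans (step-col (fwd i) j v) (cong (λ κ → κ - σ B (fwd i) * kron w v) (kron-refl v))))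
             (subst (0ℤ ≤_) (flip (σ B (fwd i)) (kron w v)) (unit-kron-nonneg (unit-neg (σ-unit (fwd i))) w v))
      where flip : ∀ σ κ → 1ℤ + - σ * κ ≡ 1ℤ - σ * κ
            flip = solve-∀
    regroup : s * (lookup x i * c) ≡ s * d * lookup x i * (d * c)
    regroup = begin
      s * (lookup x i * c)                 ≡⟨ sym (ℤP.*-identityʳ _) ⟩
      s * (lookup x i * c) * 1ℤ            ≡⟨ cong (s * (lookup x i * c) *_) (sym (unit-sq (step-unit i j))) ⟩
      s * (lookup x i * c) * (d * d)       ≡⟨ rearrange s d (lookup x i) c ⟩
      s * d * lookup x i * (d * c) ∎
      where
      open ≡-Reasoning
      rearrange : ∀ s d a c → s * (a * c) * (d * d) ≡ s * d * a * (d * c)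
      rearrange = solve-∀

  Iᵀ-push : ∀ x {v w} i (j : Joins B v (fwd i) w) s u →
    Iᵀ (x [ i ]%= (_- (s * dArr B v i))) u ≡ Iᵀ x u - s * kron v u + s * σ B (fwd i) * kron w u
  Iᵀ-push x {v} {w} i j s u = begin
    Iᵀ (x [ i ]%= (_- (s * d))) u     ≡⟨ Iᵀ-updateAt-sub x i (s * d) u ⟩
    Iᵀ x u - s * d * col B i u         ≡⟨ cong (λ z → Iᵀ x u - z) (trans (ℤP.*-assoc s d (col B i u)) (cong (s *_) (step-col (fwd i) j u))) ⟩
    Iᵀ x u - s * (kron v u - σ B (fwd i) * kron w u) ≡⟨ expand (Iᵀ x u) s (kron v u) (σ B (fwd i)) (kron w u) ⟩
    Iᵀ x u - s * kron v u + s * σ B (fwd i) * kron w u ∎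
    where
    open ≡-Reasoning
    d = dArr B v i
    expand : ∀ y s δᵥ σ δ_w → y - s * (δᵥ - σ * δ_w) ≡ y - s * δᵥ + s * σ * δ_w
    expand = solve-∀

  extend : ∀ x {a s b t i w} (j : Joins B a (fwd i) w) → IsUnit s → 0ℤ < s * dArr B a i * lookup x i →
    Decomposition (x [ i ]%= (_- (s * dArr B a i))) w (s * σ B (fwd i)) b t → Decomposition x a s b t
  extend x {a} {s} {i = i} j s-unit 0<sdxᵢ D = record
    { walk = fwd i ∷⟨ j ⟩ walk
    ; ends = ends
    ; signs = trans (sym (ℤP.*-assoc s (σ B (fwd i)) (sign walk))) signs
    ; rest = rest
    ; splits = splits′
    ; rest-ker = rest-ker
    ; rest-small = ℕP.≤-trans rest-small (ℕP.≤-trans (ℕP.n≤1+n _)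
                     (ℕP.≤-reflexive (∥∥₁-unit-step x i (unit-* s-unit (step-unit i j)) 0<sdxᵢ)))
    }
    where
    open Decomposition D
    c = s * dArr B a i
    splits′ : ∀ k → lookup x k ≡ lookup (incAux B s (fwd i ∷⟨ j ⟩ walk)) k + lookup rest k
    splits′ k = begin
      lookup x k
        ≡⟨ unshift (lookup x k) (c * kron i k) ⟩
      c * kron i k + (lookup x k - c * kron i k)
        ≡⟨ cong (λ z → c * kron i k + z) (trans (sym (lookup-updateAt-sub x i k c)) (splits k)) ⟩
      c * kron i k + (lookup (incAux B (s * σ B (fwd i)) walk) k + lookup rest k)
        ≡⟨ sym (ℤP.+-assoc (c * kron i k) _ (lookup rest k)) ⟩
      c * kron i k + lookup (incAux B (s * σ B (fwd i)) walk) k + lookup rest k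
        ≡⟨ cong (_+ lookup rest k) (sym (lookup-incAux-∷ s (fwd i) j walk k)) ⟩
      lookup (incAux B s (fwd i ∷⟨ j ⟩ walk)) k + lookup rest k ∎
      where
      open ≡-Reasoning
      unshift : ∀ a b → a ≡ b + (a - b)
      unshift = solve-∀

  decompose : ∀ F x → ∥ x ∥₁ ℕ.< F → ∀ a s b t → IsUnit s → IsUnit t →
    (∀ u → Iᵀ x u ≡ s * kron a u - t * kron b u) → Decomposition x a s b t
  decompose (suc F) x ∥x∥<F a s b t s-unit t-unit Iᵀx≡ with same-end⊎departs {a = a} {b} s-unit t-unit
  ... | inj₁ (refl , refl) = record
    { walk = [] ; ends = refl ; signs = ℤP.*-identityʳ s ; rest = x
    ; splits = λ i → sym (trans (cong (_+ lookup x i) (lookup-incAux-[] {a} s i)) (ℤP.+-identityˡ _))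
    ; rest-ker = λ u → trans (Iᵀx≡ u) (ℤP.+-inverseʳ (s * kron a u))
    ; rest-small = ℕP.≤-refl
    }
  ... | inj₂ 0<sIᵀx = advance (outgoing-arrow x a s (subst (λ z → 0ℤ < s * z) (sym (Iᵀx≡ a)) 0<sIᵀx))
    where
    advance : OutgoingArrow x a s → Decomposition x a s b t
    advance (i , w , j , 0<sdxᵢ) =
      extend x j s-unit 0<sdxᵢ (decompose F x′ ∥x′∥<F w (s * σ B (fwd i)) b t (unit-* s-unit (σ-unit (fwd i))) t-unit Iᵀx′≡)
      where
      x′ = x [ i ]%= (_- (s * dArr B a i))
      ∥x′∥<F : ∥ x′ ∥₁ ℕ.< F
      ∥x′∥<F = subst (ℕ._≤ F) (sym (∥∥₁-unit-step x i (unit-* s-unit (step-unit i j)) 0<sdxᵢ)) (ℕP.≤-pred ∥x∥<F)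
      Iᵀx′≡ : ∀ u → Iᵀ x′ u ≡ s * σ B (fwd i) * kron w u - t * kron b u
      Iᵀx′≡ u = trans (Iᵀ-push x i j s u) (trans (cong (λ y → y - s * kron a u + s * σ B (fwd i) * kron w u) (Iᵀx≡ u))
                                                (shift s t (σ B (fwd i)) (kron a u) (kron b u) (kron w u)))
        where shift : ∀ s t σ δₐ δ_b δ_w → s * δₐ - t * δ_b - s * δₐ + s * σ * δ_w ≡ s * σ * δ_w - t * δ_b
              shift = solve-∀

  ker-trivial⇒positive : (∀ x → x ≢ replicate n 0ℤ → (∀ v → Iᵀ x v ≡ 0ℤ) → ⊥) → Positive B
  ker-trivial⇒positive ker-trivial x x≢0 with 0ℤ ℤ.<? q B x
  ... | yes 0<qx = 0<qx
  ... | no q≯0 = ⊥-elim (ker-trivial x x≢0 (q≯0⇒Iᵀ≡0 x q≯0))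

  R₀-trivial⇒positive : (∀ x → R B 0ℤ x ⇔ x ≡ replicate n 0ℤ) → Positive B
  R₀-trivial⇒positive R₀-trivial = ker-trivial⇒positive λ x x≢0 Iᵀx≡0 →
    x≢0 (Equivalence.to (R₀-trivial x) (Iᵀ≡0⇒q≡0 x Iᵀx≡0))

  positive⇒R₀-trivial : Positive B → ∀ x → R B 0ℤ x ⇔ x ≡ replicate n 0ℤ
  positive⇒R₀-trivial pos x = mk⇔
    (λ qx≡0 → positive⇒ker≡0 pos x (q≡0⇒Iᵀ≡0 x qx≡0))
    (λ { refl → Iᵀ≡0⇒q≡0 (replicate n 0ℤ) Iᵀ-0 })

  record BalancedCycle : Set where
    field
      base : Fin m
      walk : Walk B base
      closed : target walk ≡ base
      balanced : sign walk ≡ 1ℤ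
      coord : Fin n
      nonzero : lookup (inc B walk) coord ≢ 0ℤ

  -- First step along i with s chosen so that s d(u,i) xᵢ > 0, then decompose the rest back to u. The
  -- leftover kernel element has smaller ℓ¹ norm than x, so the closed walk has nonzero incidence vector.
  kernel⇒cycle : ∀ x → (∀ u → Iᵀ x u ≡ 0ℤ) → ∀ i → lookup x i ≢ 0ℤ → BalancedCycle
  kernel⇒cycle x Iᵀx≡0 i xᵢ≢0 = record
    { base = u₁ B i
    ; walk = walk
    ; closed = ends
    ; balanced = unit-cancel s-unit signs
    ; coord = proj₁ inc≢0
    ; nonzero = proj₂ inc≢0
    }
    where
    j : Joins B (u₁ B i) (fwd i) (u₂ B i)
    j = inj₁ (refl , refl)
    d = dArr B (u₁ B i) i
    d-unit = step-unit i j
    sₓ = proj₁ (unit-aligned (lookup x i) xᵢ≢0)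
    s = d * sₓ
    s-unit = unit-* d-unit (proj₁ (proj₂ (unit-aligned (lookup x i) xᵢ≢0)))
    sd≡sₓ : s * d ≡ sₓ
    sd≡sₓ = trans (swap d sₓ) (trans (cong (_* sₓ) (unit-sq d-unit)) (ℤP.*-identityˡ sₓ))
      where swap : ∀ d s → d * s * d ≡ d * d * s
            swap = solve-∀
    0<sdxᵢ : 0ℤ < s * d * lookup x i
    0<sdxᵢ = subst (λ c → 0ℤ < c * lookup x i) (sym sd≡sₓ) (proj₂ (proj₂ (unit-aligned (lookup x i) xᵢ≢0)))
    x′ = x [ i ]%= (_- (s * d))
    Iᵀx′≡ : ∀ u → Iᵀ x′ u ≡ s * σ B (fwd i) * kron (u₂ B i) u - s * kron (u₁ B i) u
    Iᵀx′≡ u = trans (Iᵀ-push x i j s u) (trans (cong (λ y → y - s * kron (u₁ B i) u + s * σ B (fwd i) * kron (u₂ B i) u) (Iᵀx≡0 u))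
                                              (rotate s (σ B (fwd i)) (kron (u₁ B i) u) (kron (u₂ B i) u)))
      where rotate : ∀ s σ δ δ′ → 0ℤ - s * δ + s * σ * δ′ ≡ s * σ * δ′ - s * δ
            rotate = solve-∀
    D = decompose (suc ∥ x′ ∥₁) x′ ℕP.≤-refl (u₂ B i) (s * σ B (fwd i)) (u₁ B i) s
                  (unit-* s-unit (σ-unit (fwd i))) s-unit Iᵀx′≡
    open Decomposition (extend x j s-unit 0<sdxᵢ D)
    inc≢0 : ∃ λ k → lookup (inc B walk) k ≢ 0ℤ
    inc≢0 = FinP.¬∀⟶∃¬ n (λ k → lookup (inc B walk) k ≡ 0ℤ) (λ k → lookup (inc B walk) k ℤ.≟ 0ℤ) λ inc≡0 →
      ℕP.<-irrefl refl (subst (ℕ._< ∥ x ∥₁) (ℕΣ.sum-cong-≗ (λ k → cong ℤ.∣_∣ (sym (x≡rest inc≡0 k))))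
        (ℕP.≤-trans (s≤s (Decomposition.rest-small D)) (ℕP.≤-reflexive (∥∥₁-unit-step x i (unit-* s-unit d-unit) 0<sdxᵢ))))
      where
      x≡rest : (∀ k → lookup (inc B walk) k ≡ 0ℤ) → ∀ k → lookup x k ≡ lookup rest k
      x≡rest inc≡0 k = trans (splits k) (trans (cong (_+ lookup rest k)
        (trans (trans (cong (λ c → lookup (incAux B c walk) k) (sym (ℤP.*-identityʳ s))) (incAux-scale s 1ℤ walk k))
               (trans (cong (s *_) (inc≡0 k)) (ℤP.*-zeroʳ s)))) (ℤP.+-identityˡ (lookup rest k)))

  power : ∀ {v} (ω : Walk B v) → target ω ≡ v → ℕ → Walk B v
  power ω closed zero = []
  power ω closed (suc k) = ω ++ʷ subst (Walk B) (sym closed) (power ω closed k)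

  incAux-subst : ∀ acc {v w} (p : v ≡ w) (ω : Walk B v) → incAux B acc (subst (Walk B) p ω) ≡ incAux B acc ω
  incAux-subst acc refl ω = refl

  inc-power : ∀ {v} (ω : Walk B v) (closed : target ω ≡ v) → sign ω ≡ 1ℤ →
    ∀ k j → lookup (inc B (power ω closed k)) j ≡ + k * lookup (inc B ω) j
  inc-power {v} ω closed balanced zero j = lookup-incAux-[] {v} 1ℤ j
  inc-power ω closed balanced (suc k) j = begin
    lookup (inc B (ω ++ʷ ωᵏ)) j
      ≡⟨ incAux-++ 1ℤ ω ωᵏ j ⟩
    lookup (inc B ω) j + lookup (incAux B (1ℤ * sign ω) ωᵏ) j
      ≡⟨ cong (λ z → lookup (inc B ω) j + z)
           (trans (cong (λ c → lookup (incAux B c ωᵏ) j) (trans (ℤP.*-identityˡ (sign ω)) balanced))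
                  (trans (cong (λ z → lookup z j) (incAux-subst 1ℤ (sym closed) (power ω closed k)))
                         (inc-power ω closed balanced k j))) ⟩
    lookup (inc B ω) j + + k * lookup (inc B ω) j
      ≡⟨ collect (lookup (inc B ω) j) (+ k) ⟩
    + suc k * lookup (inc B ω) j ∎
    where
    open ≡-Reasoning
    ωᵏ = subst (Walk B) (sym closed) (power ω closed k)
    collect : ∀ a k → a + k * a ≡ (1ℤ + k) * a
    collect = solve-∀

  finite-Rinc⇒positive : FiniteSet (Rinc B) → Positive B
  finite-Rinc⇒positive finite = ker-trivial⇒positive λ x x≢0 Iᵀx≡0 →
    let i , xᵢ≢0 = nonzero-entry x x≢0
        open BalancedCycle (kernel⇒cycle x Iᵀx≡0 i xᵢ≢0)
    in finite⇒¬progression finite (λ k → inc B (power walk closed k)) (λ k → base , power walk closed k , inj₁ refl)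
         coord 0ℤ (lookup (inc B walk) coord) nonzero
         (λ k → trans (inc-power walk closed balanced k coord) (sym (ℤP.+-identityˡ _)))

  unit-multiple-of-inc : ∀ {v} x s (ω : Walk B v) → IsUnit s → (∀ k → lookup x k ≡ s * lookup (inc B ω) k) →
    x ≡ inc B ω ⊎ x ≡ -ᵥ_ B (inc B ω)
  unit-multiple-of-inc x s ω (inj₁ refl) x≡ = inj₁ (vec-ext λ k → trans (x≡ k) (ℤP.*-identityˡ _))
  unit-multiple-of-inc x s ω (inj₂ refl) x≡ = inj₂ (vec-ext λ k →
    trans (x≡ k) (trans (ℤP.-1*i≡-i _) (sym (VecP.lookup-map k -_ (inc B ω)))))

  positive⇒two-term-Rinc : Positive B → ∀ x a b s t → IsUnit s → IsUnit t →
    (∀ u → Iᵀ x u ≡ s * kron a u + t * kron b u) → Rinc B x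
  positive⇒two-term-Rinc pos x a b s t s-unit t-unit Iᵀx≡ = a , walk , unit-multiple-of-inc x s walk s-unit x≡s·inc
    where
    D = decompose (suc ∥ x ∥₁) x ℕP.≤-refl a s b (- t) s-unit (unit-neg t-unit)
          (λ u → trans (Iᵀx≡ u) (flip s t (kron a u) (kron b u)))
      where flip : ∀ s t δ δ′ → s * δ + t * δ′ ≡ s * δ - (- t) * δ′
            flip = solve-∀
    open Decomposition D
    x≡s·inc : ∀ k → lookup x k ≡ s * lookup (inc B walk) k
    x≡s·inc k = trans (splits k) (trans
      (cong₂ _+_ (trans (cong (λ c → lookup (incAux B c walk) k) (sym (ℤP.*-identityʳ s))) (incAux-scale s 1ℤ walk k))
                 (trans (cong (λ r → lookup r k) (positive⇒ker≡0 pos rest rest-ker)) (VecP.lookup-replicate k 0ℤ)))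
      (ℤP.+-identityʳ _))

  positive⇒R₁⊆Rinc : Positive B → ∀ x → R B 1ℤ x → Rinc B x
  positive⇒R₁⊆Rinc pos x qx≡1 =
    let a , b , s , t , s-unit , t-unit , Iᵀx≡ = sumSq≡2 (Iᵀ x) (trans (sym (q-Gram x)) (cong (_* + 2) qx≡1))
    in positive⇒two-term-Rinc pos x a b s t s-unit t-unit Iᵀx≡

  -- If every arrow is a loop, every column of I is even, so q = 2 q′ with q′ integral.
  all-loops⇒¬irreducible : (∀ i → u₁ B i ≡ u₂ B i) → ¬ Irreducible B
  all-loops⇒¬irreducible loops irr = 2-nonunit (irr (+ 2) c c₂ qDiag≡ (λ i j _ → qOff≡ i j))
    where
    2-nonunit : ¬ IsUnit (+ 2)
    2-nonunit (inj₁ ())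
    2-nonunit (inj₂ ())
    half : Fin n → Fin m → ℤ
    half i v = proj₁ (sign-sum-even (ε₁ B i) (ε₂ B i)) * kron (u₁ B i) v
    col≡ : ∀ i v → col B i v ≡ + 2 * half i v
    col≡ i v = begin
      s₁ * kron (u₁ B i) v + s₂ * kron (u₂ B i) v ≡⟨ cong (λ a → s₁ * kron (u₁ B i) v + s₂ * kron a v) (sym (loops i)) ⟩
      s₁ * kron (u₁ B i) v + s₂ * kron (u₁ B i) v ≡⟨ sym (ℤP.*-distribʳ-+ (kron (u₁ B i) v) s₁ s₂) ⟩
      (s₁ + s₂) * kron (u₁ B i) v                  ≡⟨ cong (_* kron (u₁ B i) v) (proj₂ (sign-sum-even (ε₁ B i) (ε₂ B i))) ⟩
      + 2 * h * kron (u₁ B i) v                    ≡⟨ ℤP.*-assoc (+ 2) h (kron (u₁ B i) v) ⟩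
      + 2 * half i v ∎
      where
      open ≡-Reasoning
      s₁ = signℤ (ε₁ B i)
      s₂ = signℤ (ε₂ B i)
      h = proj₁ (sign-sum-even (ε₁ B i) (ε₂ B i))
    c₂ : Fin n → Fin n → ℤ
    c₂ i j = + 2 * ∑[ v < m ] (half i v * half j v)
    qOff≡ : ∀ i j → qOff B i j ≡ + 2 * c₂ i j
    qOff≡ i j = trans (qOff≡∑ i j) (trans
      (sum-cong-≗ (λ v → trans (cong₂ _*_ (col≡ i v) (col≡ j v)) (regroup (half i v) (half j v))))
      (trans (sym (*-distribˡ-sum (+ 2 * + 2) (λ v → half i v * half j v))) (ℤP.*-assoc (+ 2) (+ 2) _)))
      where regroup : ∀ a b → + 2 * a * (+ 2 * b) ≡ + 2 * + 2 * (a * b)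
            regroup = solve-∀
    c : Fin n → ℤ
    c i = ∑[ v < m ] (half i v * half i v)
    qDiag≡ : ∀ i → qDiag B i ≡ + 2 * c i
    qDiag≡ i = ℤP.*-cancelʳ-≡ (qDiag B i) (+ 2 * c i) (+ 2)
      (trans (qDiag*2≡qOff i) (trans (qOff≡ i i) (ℤP.*-comm (+ 2) (+ 2 * c i))))

  irreducible⇒proper-arrow : Irreducible B → ∃ λ i → u₁ B i ≢ u₂ B i
  irreducible⇒proper-arrow irr = FinP.¬∀⟶∃¬ n (λ i → u₁ B i ≡ u₂ B i) (λ i → u₁ B i Fin.≟ u₂ B i)
    (λ loops → all-loops⇒¬irreducible loops irr)

  qDiag-proper : ∀ i → u₁ B i ≢ u₂ B i → qDiag B i ≡ 1ℤ
  qDiag-proper i proper = trans (qDiag≡selfPairing i)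
    (trans (cong (λ κ → 1ℤ + pairSign i * κ) (kron-≢ proper)) (cong (λ z → 1ℤ + z) (ℤP.*-zeroʳ (pairSign i))))

  -- For a proper arrow i and a kernel element x, every eᵢ + k x is a root of q - 1.
  finite-R₁⇒positive : Irreducible B → FiniteSet (R B 1ℤ) → Positive B
  finite-R₁⇒positive irr finite = ker-trivial⇒positive λ x x≢0 Iᵀx≡0 →
    let i , proper = irreducible⇒proper-arrow irr
        j , xⱼ≢0 = nonzero-entry x x≢0
        y = λ (k : ℕ) → _+ᵥ_ B (e B i) (_·ᵥ_ B (+ k) x)
        Iᵀy≡col : ∀ k v → Iᵀ (y k) v ≡ col B i v
        Iᵀy≡col k v = trans (Iᵀ-+ (e B i) (_·ᵥ_ B (+ k) x) v) (trans
          (cong₂ _+_ (Iᵀ-e i v) (trans (Iᵀ-· (+ k) x v) (trans (cong (+ k *_) (Iᵀx≡0 v)) (ℤP.*-zeroʳ (+ k)))))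
          (ℤP.+-identityʳ (col B i v)))
    in finite⇒¬progression finite y (λ k → trans (Iᵀ≡col⇒q≡qDiag (y k) i (Iᵀy≡col k)) (qDiag-proper i proper))
         j (kron i j) (lookup x j) xⱼ≢0
         (λ k → trans (VecP.lookup-zipWith _+_ j (e B i) (_·ᵥ_ B (+ k) x))
                      (cong₂ _+_ (VecP.lookup∘tabulate (kron i) j) (VecP.lookup-map j (+ k *_) x)))

  State : Set
  State = Fin m × ℤ

  _≟ₛ_ : DecidableEquality State
  _≟ₛ_ = ×P.≡-dec Fin._≟_ ℤ._≟_

  open import Data.List.Membership.DecPropositional _≟ₛ_ using (_∈?_)

  states : ∀ {v} → ℤ → Walk B v → List State
  states {v} acc [] = (v , acc) ∷ []
  states {v} acc (s ∷⟨ _ ⟩ ω) = (v , acc) ∷ states (acc * σ B s) ω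

  suffix-from : ∀ {v} acc (ω : Walk B v) → Unique (states acc ω) → ∀ {v′ acc′} → (v′ , acc′) ∈ states acc ω →
    Σ[ ω′ ∈ Walk B v′ ] target ω′ ≡ target ω × acc′ * sign ω′ ≡ acc * sign ω × Unique (states acc′ ω′)
  suffix-from acc [] unique (here refl) = [] , refl , refl , unique
  suffix-from acc (s ∷⟨ j ⟩ ω) unique (here refl) = s ∷⟨ j ⟩ ω , refl , refl , unique
  suffix-from acc (s ∷⟨ j ⟩ ω) (_ ∷ unique) (there p) with suffix-from (acc * σ B s) ω unique p
  ... | ω′ , same-target , same-sign , unique′ = ω′ , same-target , trans same-sign (ℤP.*-assoc acc (σ B s) (sign ω)) , unique′

  record LoopFree {v} (acc : ℤ) (ω : Walk B v) : Set where
    constructor loopFree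
    field
      walk : Walk B v
      same-target : target walk ≡ target ω
      same-sign : acc * sign walk ≡ acc * sign ω
      unique-states : Unique (states acc walk)

  erase-loops : ∀ {v} acc (ω : Walk B v) → LoopFree acc ω
  erase-loops acc [] = loopFree [] refl refl ([] ∷ [])
  erase-loops {v} acc (s ∷⟨ j ⟩ ω) with erase-loops (acc * σ B s) ω
  ... | loopFree ω₁ target₁ sign₁ unique₁ with (v , acc) ∈? states (acc * σ B s) ω₁
  ...   | yes revisit = let ω₂ , target₂ , sign₂ , unique₂ = suffix-from (acc * σ B s) ω₁ unique₁ revisit in
          loopFree ω₂ (trans target₂ target₁) (trans sign₂ (trans sign₁ (ℤP.*-assoc acc (σ B s) (sign ω)))) unique₂
  ...   | no fresh = loopFree (s ∷⟨ j ⟩ ω₁) target₁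
          (trans (sym (ℤP.*-assoc acc (σ B s) (sign ω₁))) (trans sign₁ (ℤP.*-assoc acc (σ B s) (sign ω))))
          (¬Any⇒All¬ _ fresh ∷ unique₁)

  signed-vertices : List State
  signed-vertices = List.cartesianProduct (List.allFin m) (1ℤ ∷ -1ℤ ∷ [])

  states⊆signed-vertices : ∀ {v} acc (ω : Walk B v) → IsUnit acc → states acc ω ⊆ signed-vertices
  states⊆signed-vertices {v} acc [] acc-unit (here refl) = ∈-cartesianProduct⁺ (∈-allFin v) (unit∈ acc-unit)
    where unit∈ : ∀ {a} → IsUnit a → a ∈ 1ℤ ∷ -1ℤ ∷ []
          unit∈ (inj₁ refl) = here refl
          unit∈ (inj₂ refl) = there (here refl)
  states⊆signed-vertices {v} acc (_ ∷⟨ _ ⟩ ω) acc-unit (here refl) = states⊆signed-vertices {v} acc [] acc-unit (here refl)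
  states⊆signed-vertices acc (s ∷⟨ _ ⟩ ω) acc-unit (there p) = states⊆signed-vertices (acc * σ B s) ω (unit-* acc-unit (σ-unit s)) p

  length-states : ∀ {v} acc (ω : Walk B v) → length (states acc ω) ≡ suc (len ω)
  length-states acc [] = refl
  length-states acc (s ∷⟨ _ ⟩ ω) = cong suc (length-states (acc * σ B s) ω)

  shorten : ∀ {v} (ω : Walk B v) →
    Σ[ ω′ ∈ Walk B v ] target ω′ ≡ target ω × sign ω′ ≡ sign ω × len ω′ ℕ.< length signed-vertices
  shorten ω with erase-loops 1ℤ ω
  ... | loopFree ω′ same-target same-sign unique = ω′ , same-target ,
    trans (sym (ℤP.*-identityˡ (sign ω′))) (trans same-sign (ℤP.*-identityˡ (sign ω))) ,
    subst (ℕ._≤ length signed-vertices) (length-states 1ℤ ω′)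
      (unique-⊆⇒length≤ _≟ₛ_ unique (states⊆signed-vertices 1ℤ ω′ (inj₁ refl)))

  prepend : ℤ → Fin n → Vec ℤ n → Vec ℤ n
  prepend c i r = _+ᵥ_ B (_·ᵥ_ B c (e B i)) r

  short-incs : ℕ → ℤ → Fin m → List (Vec ℤ n)
  short-incs zero acc v = replicate n 0ℤ ∷ []
  short-incs (suc k) acc v = replicate n 0ℤ ∷ List.concat (List.tabulate λ i → List.concat (List.tabulate λ w →
    List.map (prepend (acc * dArr B v i) i) (short-incs k (acc * σ B (fwd i)) w)
    List.++ List.map (prepend (acc * -1ℤ) i) (short-incs k (acc * σ B (fwd i)) w)))

  ∈-short-incs : ∀ k acc {v} (ω : Walk B v) → len ω ℕ.≤ k → incAux B acc ω ∈ short-incs k acc v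
  ∈-short-incs zero acc [] _ = here refl
  ∈-short-incs (suc k) acc [] _ = here refl
  ∈-short-incs (suc k) acc (_∷⟨_⟩_ {w = w} (fwd i) j ω) (s≤s len≤k) = there
    (∈-concat⁺′ (∈-concat⁺′ (∈-++⁺ˡ (∈-map⁺ _ (∈-short-incs k _ ω len≤k))) (∈-tabulate⁺ w)) (∈-tabulate⁺ i))
  ∈-short-incs (suc k) acc {v} (_∷⟨_⟩_ {w = w} (inv i _) j ω) (s≤s len≤k) = there
    (∈-concat⁺′ (∈-concat⁺′ (∈-++⁺ʳ (List.map (prepend (acc * dArr B v i) i) (short-incs k (acc * σ B (fwd i)) w))
                                     (∈-map⁺ _ (∈-short-incs k _ ω len≤k)))
                           (∈-tabulate⁺ w)) (∈-tabulate⁺ i))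

  positive⇒inc-short : Positive B → ∀ {v} (ω : Walk B v) → inc B ω ∈ short-incs (length signed-vertices) 1ℤ v
  positive⇒inc-short pos {v} ω with shorten ω
  ... | ω′ , same-target , same-sign , short = subst (_∈ short-incs (length signed-vertices) 1ℤ v)
    (positive⇒Iᵀ-injective pos (inc B ω′) (inc B ω) λ u →
      trans (Iᵀ-incAux 1ℤ ω′ u) (trans (cong₂ (λ sg t → 1ℤ * kron v u - 1ℤ * sg * kron t u) same-sign same-target)
                                       (sym (Iᵀ-incAux 1ℤ ω u))))
    (∈-short-incs _ 1ℤ ω′ (ℕP.<⇒≤ short))

  positive⇒finite-Rinc : Positive B → FiniteSet (Rinc B)
  positive⇒finite-Rinc pos = List.concat (List.map (λ v → incs v List.++ List.map (-ᵥ_ B) (incs v)) (List.allFin m)) , λ where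
      x (v , ω , inj₁ refl) → ∈-concat⁺′ (∈-++⁺ˡ (positive⇒inc-short pos ω)) (∈-map⁺ _ (∈-allFin v))
      x (v , ω , inj₂ refl) → ∈-concat⁺′ (∈-++⁺ʳ (incs v) (∈-map⁺ (-ᵥ_ B) (positive⇒inc-short pos ω))) (∈-map⁺ _ (∈-allFin v))
    where
    incs : Fin m → List (Vec ℤ n)
    incs = short-incs (length signed-vertices) 1ℤ

  positive⇒finite-R₁ : Positive B → FiniteSet (R B 1ℤ)
  positive⇒finite-R₁ pos = proj₁ (positive⇒finite-Rinc pos) ,
    λ x qx≡1 → proj₂ (positive⇒finite-Rinc pos) x (positive⇒R₁⊆Rinc pos x qx≡1)

proposition7p2 : ∀ {m n : ℕ} (B : BiGraph m n) → 1 ℕ.≤ n →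
    Connected B → Irreducible B →
    (Positive B ⇔ (∀ (x : Vec ℤ n) → R B 0ℤ x ⇔ x ≡ replicate n 0ℤ))
    × (Positive B ⇔ FiniteSet (R B 1ℤ))
    × (Positive B ⇔ FiniteSet (Rinc B))
proposition7p2 B _ _ irreducible =
    mk⇔ (positive⇒R₀-trivial B) (R₀-trivial⇒positive B)
  , mk⇔ (positive⇒finite-R₁ B) (finite-R₁⇒positive B irreducible)
  , mk⇔ (positive⇒finite-Rinc B) (finite-Rinc⇒positive B)
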